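{- Let $\mathcal C$ be a $3$-harmonious coherent configuration, and let $S$ be a set of edges of its fiber graph $\Gamma(\mathcal C)$. Then $f_S$ is a strict algebraic automorphism of $\mathcal C$ if and only if, for each $C\in\mathcal D(\mathcal C)$, the set $S$ contains exactly two or no edges $\{X,Y\}$ with $X,Y\in C$.
   Context: A coherent configuration on a finite set $V$ is a partition $\mathcal C$ of $V\times V$ into basis relations such that: (A) a basis relation containing a loop consists of loops; (B) the transpose of a basis relation is a basis relation; (C) for all $R,S,T\in\mathcal C$ the number $|\{w:uw\in R,wv\in S\}|$ is the same for all $uv\in T$, denoted $p^T_{RS}$. Fibers are sets $X$ with $\{xx:x\in X\}\in\mathcal C$; $\mathcal C[X,Y]$ is the set of basis relations in $X\times Y$; $\mathcal C[X]=\mathcal C[X,X]$ is a cell; $\mathcal C[X,Y]$ ($X\ne Y$) is uniform if it equals $\{X\times Y\}$. For distinct 4-point fibers, $\mathcal C[X,Y]$ is of type $2K_{2,2}$ if it consists of two basis relations $R$ and $(X\times Y)\setminus R$ with $R=\{x_1,x_2\}\times\{y_1,y_2\}\cup\{x_3,x_4\}\times\{y_3,y_4\}$ for suitable enumerations; it then determines in $Y$ the relation $\{y_1y_2,y_2y_1,y_3y_4,y_4y_3\}$. Interspaces $\mathcal C[X,Y],\mathcal C[Z,Y]$ of type $2K_{2,2}$ are directly connected at $Y$ if they determine the same relation in $Y$. $\mathcal C$ is irredundant if it is indecomposable (fibers cannot be split into two nonempty parts with all interspaces between parts uniform), all fibers have size 4, and all non-uniform interspaces are of type $2K_{2,2}$.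 The fiber graph $\Gamma(\mathcal C)$ has the fibers as vertices, $X,Y$ adjacent iff $\mathcal C[X,Y]$ is non-uniform. For a non-uniform $\mathcal C[X,Y]$, $D(X,Y)$ is the set of fibers consisting of $X$, $Y$ and all $Z$ such that $\mathcal C[Z,X]$ is non-uniform and directly connected with $\mathcal C[Y,X]$ at $X$; $\mathcal D(\mathcal C)$ is the family of all such sets $D(X,Y)$. $\mathcal C$ is 3-harmonious if it is irredundant, every fiber belongs to exactly three members of $\mathcal D(\mathcal C)$, and every member of $\mathcal D(\mathcal C)$ has exactly three elements. For $S\subseteq E(\Gamma(\mathcal C))$, $f_S$ is the permutation of $\mathcal C$ interchanging the two basis relations of $\mathcal C[X,Y]$ and those of $\mathcal C[Y,X]$ for each $\{X,Y\}\in S$ and fixing all other basis relations. A strict algebraic automorphism is a bijection $f:\mathcal C\to\mathcal C$ with $p^T_{RS}=p^{f(T)}_{f(R)f(S)}$ for all $R,S,T$ and $f(R)=R$ for every $R$ in every cell. -}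

module Defs where

open import Data.Nat using (ℕ)
open import Data.Bool using (Bool; true; false)
open import Data.Fin using (Fin; zero; suc; _<_; _<?_)
open import Data.Fin.Properties using (_≟_)
open import Data.Fin.Subset using (Subset; _∈_; ∣_∣)
open import Data.Fin.Subset.Properties using (_∈?_)
open import Data.List using (List; length; filter; allFin; concatMap; map)
open import Data.Product using (Σ; ∃; ∃₂; _×_; _,_)
open import Data.Sum using (_⊎_)
open import Relation.Nullary using (¬_)
open import Relation.Nullary.Decidable using (_×-dec_)
open import Relation.Binary.PropositionalEquality using (_≡_; _≢_)
open import Function.Bundles using (_⇔_)
open import Function.Definitions using (Bijective; Injective)

-- Coherent configurations on V = Fin n with basis relations indexed by
-- Fin m.  The partition of V × V into basis relations is given by the
-- colouring  col : V → V → Fin m ; the basis relation R is the colour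
-- class { uv | col u v ≡ R }, which must be nonempty.

countPaths : ∀ {n m} → (Fin n → Fin n → Fin m) →
             Fin n → Fin n → Fin m → Fin m → ℕ
countPaths {n} col u v R S =
  length (filter (λ w → (col u w ≟ R) ×-dec (col w v ≟ S)) (allFin n))

record CoherentConfiguration (n m : ℕ) : Set where
  field
    col      : Fin n → Fin n → Fin m
    nonempty : ∀ (R : Fin m) → ∃₂ λ u v → col u v ≡ R
    -- (A) a basis relation containing a loop consists of loops
    loops    : ∀ u v w → col u u ≡ col v w → v ≡ w
    transp   : ∀ (R : Fin m) → ∃ λ R' → ∀ u v → (col u v ≡ R) ⇔ (col v u ≡ R')
    -- (C) intersection numbers p^T_{RS}, indexed  p T R S
    p        : Fin m → Fin m → Fin m → ℕ
    coh      : ∀ u v R S → countPaths col u v R S ≡ p (col u v) R S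

blk : Fin 4 → Fin 2
blk zero                   = zero
blk (suc zero)             = zero
blk (suc (suc zero))       = suc zero
blk (suc (suc (suc zero))) = suc zero

module _ {n m : ℕ} (𝒞 : CoherentConfiguration n m) where
  open CoherentConfiguration 𝒞

  -- Fibers are identified with the basis relation {xx | x ∈ X} (a colour).
  IsFiber : Fin m → Set
  IsFiber X = ∃ λ x → col x x ≡ X

  _∈F_ : Fin n → Fin m → Set
  x ∈F X = col x x ≡ X

  fiberSize : Fin m → ℕ
  fiberSize X = length (filter (λ x → col x x ≟ X) (allFin n))

  InRel : Fin m → Fin m → Fin m → Set
  InRel R X Y = ∀ u v → col u v ≡ R → (u ∈F X) × (v ∈F Y)

  Uniform : Fin m → Fin m → Set
  Uniform X Y = ∃ λ R → ∀ u v → (col u v ≡ R) ⇔ ((u ∈F X) × (v ∈F Y))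

  -- X,Y distinct fibers with C[X,Y] non-uniform (= edge of Γ(𝒞))
  NonUniform : Fin m → Fin m → Set
  NonUniform X Y = IsFiber X × IsFiber Y × X ≢ Y × ¬ Uniform X Y

  -- C[X,Y] of type 2K_{2,2}, together with the witnessing enumerations
  -- x_i = ex i, y_i = ey i and the two basis relations r (= R) and r'.
  record Type2K22 (X Y : Fin m) : Set where
    field
      ex     : Fin 4 → Fin n
      ey     : Fin 4 → Fin n
      ex-inj : Injective _≡_ _≡_ ex
      ey-inj : Injective _≡_ _≡_ ey
      ex-in  : ∀ a → ex a ∈F X
      ey-in  : ∀ a → ey a ∈F Y
      ex-all : ∀ x → x ∈F X → ∃ λ a → ex a ≡ x
      ey-all : ∀ y → y ∈F Y → ∃ λ a → ey a ≡ y
      r      : Fin m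
      r'     : Fin m
      r-spec  : ∀ u v → (col u v ≡ r) ⇔
                (∃₂ λ a b → u ≡ ex a × v ≡ ey b × blk a ≡ blk b)
      r'-spec : ∀ u v → (col u v ≡ r') ⇔
                (∃₂ λ a b → u ≡ ex a × v ≡ ey b × blk a ≢ blk b)

  detRel : ∀ {X Y} → Type2K22 X Y → Fin n → Fin n → Set
  detRel t y y' = ∃₂ λ a b → y ≡ ey a × y' ≡ ey b × a ≢ b × blk a ≡ blk b
    where open Type2K22 t

  DirectlyConnected : Fin m → Fin m → Fin m → Set
  DirectlyConnected X Z Y =
    Σ (Type2K22 X Y) λ t₁ → Σ (Type2K22 Z Y) λ t₂ →
      ∀ y y' → detRel t₁ y y' ⇔ detRel t₂ y y'

  InD : Fin m → Fin m → Fin m → Set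
  InD X Y Z = Z ≡ X ⊎ Z ≡ Y ⊎ (NonUniform Z X × DirectlyConnected Z Y X)

  InFamD : Subset m → Set
  InFamD C = ∃₂ λ X Y → NonUniform X Y × (∀ Z → (Z ∈ C) ⇔ InD X Y Z)

  Indecomposable : Set
  Indecomposable = ¬ (Σ (Fin m → Bool) λ P →
      (∃ λ X → IsFiber X × P X ≡ true) ×
      (∃ λ Y → IsFiber Y × P Y ≡ false) ×
      (∀ X Y → IsFiber X → IsFiber Y → P X ≡ true → P Y ≡ false → Uniform X Y))

  record Irredundant : Set where
    field
      indecomposable : Indecomposable
      size4          : ∀ X → IsFiber X → fiberSize X ≡ 4
      type2K22       : ∀ X Y → NonUniform X Y → Type2K22 X Y

  record ThreeHarmonious : Set where
    field
      irredundant : Irredundant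
      three-members : ∀ X → IsFiber X →
        Σ (Subset m) λ C₁ → Σ (Subset m) λ C₂ → Σ (Subset m) λ C₃ →
          (C₁ ≢ C₂ × C₁ ≢ C₃ × C₂ ≢ C₃) ×
          (InFamD C₁ × X ∈ C₁) × (InFamD C₂ × X ∈ C₂) × (InFamD C₃ × X ∈ C₃) ×
          (∀ C → InFamD C → X ∈ C → C ≡ C₁ ⊎ C ≡ C₂ ⊎ C ≡ C₃)
      three-elements : ∀ C → InFamD C → ∣ C ∣ ≡ 3

  -- A set S of edges of Γ(𝒞), given as a symmetric Boolean relation on
  -- fibers supported on edges ({X,Y} ∈ S  iff  S X Y ≡ true).
  IsEdgeSet : (Fin m → Fin m → Bool) → Set
  IsEdgeSet S = (∀ X Y → S X Y ≡ S Y X) × (∀ X Y → S X Y ≡ true → NonUniform X Y)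

  -- f is the permutation f_S: for each basis relation R ⊆ X × Y it swaps R
  -- with the other basis relation of C[X,Y] when {X,Y} ∈ S, and fixes R
  -- otherwise.
  IsFS : (Fin m → Fin m → Bool) → (Fin m → Fin m) → Set
  IsFS S f = ∀ R X Y → IsFiber X → IsFiber Y → InRel R X Y →
    (S X Y ≡ true → f R ≢ R × InRel (f R) X Y) × (S X Y ≡ false → f R ≡ R)

  StrictAlgAut : (Fin m → Fin m) → Set
  StrictAlgAut f = Bijective _≡_ _≡_ f ×
    (∀ R S T → p T R S ≡ p (f T) (f R) (f S)) ×
    (∀ R X → IsFiber X → InRel R X X → f R ≡ R)

edgeCount : ∀ {m} → (Fin m → Fin m → Bool) → Subset m → ℕ
edgeCount {m} S C = length (filter
  (λ { (X , Y) → (X <? Y) ×-dec ((X ∈? C) ×-dec ((Y ∈? C) ×-dec (S X Y Data.Bool.≟ true))) })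
  (concatMap (λ X → map (λ Y → (X , Y)) (allFin m)) (allFin m)))

-- Each non-uniform interspace C[X,Y] splits X and Y into two blocks of two points, and its two
-- basis relations say whether the blocks of x ∈ X and y ∈ Y are equal. With blocks read as bits,
-- the colour of xy is a function of βx ⊕ βy, and f_S adds S(X,Y) to that bit.
--
-- An intersection number p^T_{RS} counts the midpoints w of paths u → w → v with uw ∈ R, wv ∈ S.
-- It is preserved by f_S as soon as uv ∈ T can be replaced by some u'v' ∈ f_S(T) whose row sees
-- f_S(R) exactly where the row of u saw R, and whose column sees f_S(S) where that of v saw S.
-- Such a u' is u moved by S(X,Y) within its C[X,Y]-block, and v' is v moved by S(Y,Z); landing in
-- f_S(T) asks that their C[X,Z]-blocks move by amounts adding up to S(X,Z). The C[X,Z]-block of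
-- u' can be chosen freely unless C[X,Y] and C[X,Z] split X alike, i.e. unless C[Y,X] and C[Z,X]
-- are directly connected, and likewise for v'. If both are forced, {X,Y,Z} = D(X,Z) ∈ 𝒟 and the
-- forced moves fit exactly when S has 0 or 2 edges in it. When X = Z, f_S fixes T and the midpoint
-- is moved instead, by swapping the blocks of Y. Conversely, for D(X,Y) = {X,Y,Z}, the two paths
-- between y ∈ Y and z ∈ Z through one block of X survive f_S only under that same parity.

module Submission where

open import Defs
open import Algebra.Bundles using (CommutativeRing)
import Algebra.Properties.CommutativeSemigroup as CommutativeSemigroupProperties
open import Data.Bool using (Bool; true; false; not; _xor_)
open import Data.Bool.Properties
  using ( not-involutive; not-¬; xor-same; xor-assoc; xor-comm; xor-identityʳ; xor-inverseˡ
        ; xor-∧-commutativeRing)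
  renaming (_≟_ to _≟ᵇ_)
open import Data.Empty using (⊥; ⊥-elim)
open import Data.Fin using (Fin; zero; suc; _<_; _<?_)
open import Data.Fin.Properties using (_≟_; all?; any?; <-asym; <-irrefl; <-cmp)
open import Data.Fin.Subset using (Subset; _∈_; _⊆_; ∣_∣; inside; outside; _-_; _∪_; _∩_; ∁; ⁅_⁆)
open import Data.Fin.Subset.Properties
  using ( _∈?_; x∈p⇒∣p-x∣<∣p∣; x∈p∧x≢y⇒x∈p-y; Empty-unique; ∣⊥∣≡0; ∣⁅x⁆∣≡1; p⊆q⇒∣p∣≤∣q∣
        ; ∣p∣≤∣x∷p∣; x∈p∪q⁺; x∈p∩q⁺; x∈p∩q⁻; x∈⁅x⁆; x≢y⇒x∉⁅y⁆; x∉p⇒x∈∁p; x∈∁p⇒x∉p)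
open import Data.List
  using (List; []; _∷_; length; filter; allFin; concatMap; map; cartesianProduct; _++_)
open import Data.List.Membership.Propositional using () renaming (_∈_ to _∈ₗ_)
open import Data.List.Membership.Propositional.Properties
  using (∈-filter⁺; ∈-filter⁻; ∈-++⁺ˡ; ∈-++⁺ʳ; ∈-++⁻; ∈-map⁺; ∈-map⁻; ∈-allFin; ∈-cartesianProduct⁺)
open import Data.List.Membership.Propositional.Properties.WithK using (unique∧set⇒bag)
open import Data.List.Properties using (length-++; length-map)
open import Data.List.Relation.Binary.BagAndSetEquality using (∼bag⇒↭)
open import Data.List.Relation.Binary.Permutation.Propositional.Properties using (↭-length)
import Data.List.Relation.Unary.All as All
import Data.List.Relation.Unary.AllPairs as AllPairs
open import Data.List.Relation.Unary.Any using (here; there)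
open import Data.List.Relation.Unary.Unique.Propositional using (Unique)
import Data.List.Relation.Unary.Unique.Propositional.Properties as Unique
open import Data.Nat using (ℕ; zero; suc; _+_; _≤_; z≤n; s≤s)
import Data.Nat.Properties as ℕ
open import Data.Product using (∃; ∃₂; _×_; _,_; proj₁; proj₂)
open import Data.Product.Function.NonDependent.Propositional using (_×-⇔_)
open import Data.Product.Properties using (≡-dec; ×-≡,≡←≡)
open import Data.Sum using (_⊎_; inj₁; inj₂)
open import Data.Unit using (tt)
open import Data.Vec using ([]; _∷_; here; there; lookup; tabulate)
open import Data.Vec.Properties using (lookup∘tabulate; []=⇒lookup; lookup⇒[]=)
open import Function using (_∘_; id; case_of_)
open import Function.Bundles using (_⇔_; mk⇔; Equivalence)
open import Function.Consequences.Propositional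
  using (inverseᵇ⇒bijective; strictlyInverseˡ⇒inverseˡ; strictlyInverseʳ⇒inverseʳ)
open import Function.Definitions using (Bijective; Injective)
open import Relation.Binary.Definitions using (tri<; tri≈; tri>)
open import Relation.Binary.PropositionalEquality
  using (_≡_; _≢_; refl; sym; trans; cong; cong₂; subst; module ≡-Reasoning)
open import Relation.Nullary using (¬_; Dec; yes; no; does)
open import Relation.Nullary.Decidable using (_×-dec_; _⊎-dec_; _→-dec_; ¬?; toWitness; map′; dec-true)
open import Relation.Unary using (Decidable)

open Equivalence using (to; from)

-- Counting the elements of a complete list

module Counting {A : Set} (xs : List A) (xs-unique : Unique xs) (xs-complete : ∀ z → z ∈ₗ xs) where

  count : {P : A → Set} → Decidable P → ℕ
  count P? = length (filter P? xs)

  module _ {P : A → Set} (P? : Decidable P) where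

    ∈-filter⇔ : ∀ z → z ∈ₗ filter P? xs ⇔ P z
    ∈-filter⇔ z = mk⇔ (proj₂ ∘ ∈-filter⁻ P? {xs = xs}) (∈-filter⁺ P? (xs-complete z))

    count≡length : (L : List A) → Unique L → (∀ z → P z ⇔ z ∈ₗ L) → count P? ≡ length L
    count≡length L L-unique P⇔∈L = ↭-length (∼bag⇒↭ (unique∧set⇒bag
      (Unique.filter⁺ P? xs-unique) L-unique
      λ {z} → mk⇔ (to (P⇔∈L z) ∘ to (∈-filter⇔ z)) (from (∈-filter⇔ z) ∘ from (P⇔∈L z))))

    count≡0 : (∀ z → ¬ P z) → count P? ≡ 0
    count≡0 ¬P = count≡length [] AllPairs.[] λ z → mk⇔ (⊥-elim ∘ ¬P z) λ ()

    count≡1 : (c : A) → (∀ z → P z ⇔ z ≡ c) → count P? ≡ 1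
    count≡1 c P⇔≡c = count≡length (c ∷ []) (All.[] AllPairs.∷ AllPairs.[]) λ z → mk⇔
      (here ∘ to (P⇔≡c z)) λ { (here z≡c) → from (P⇔≡c z) z≡c ; (there ()) }

    count≢0 : ∀ z → P z → count P? ≢ 0
    count≢0 z Pz with filter P? xs | from (∈-filter⇔ z) Pz
    ... | _ ∷ _ | _ = λ ()

    count≢0⇒∃ : count P? ≢ 0 → ∃ P
    count≢0⇒∃ nonzero with filter P? xs in eq
    ... | [] = ⊥-elim (nonzero refl)
    ... | z ∷ _ = z , to (∈-filter⇔ z) (subst (z ∈ₗ_) (sym eq) (here refl))

  module _ {P Q : A → Set} (P? : Decidable P) (Q? : Decidable Q) where

    count-cong : (∀ z → P z ⇔ Q z) → count P? ≡ count Q?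
    count-cong P⇔Q = count≡length P? _ (Unique.filter⁺ Q? xs-unique) λ z → mk⇔
      (from (∈-filter⇔ Q? z) ∘ to (P⇔Q z)) (from (P⇔Q z) ∘ to (∈-filter⇔ Q? z))

    count-split : count P? ≡ count (λ z → P? z ×-dec Q? z) + count (λ z → P? z ×-dec ¬? (Q? z))
    count-split = trans (count≡length P? _ (Unique.++⁺ (Unique.filter⁺ PQ? xs-unique)
                           (Unique.filter⁺ P¬Q? xs-unique) disjoint) P⇔∈)
                        (length-++ (filter PQ? xs))
      where
      PQ? = λ z → P? z ×-dec Q? z
      P¬Q? = λ z → P? z ×-dec ¬? (Q? z)
      disjoint : ∀ {z} → ¬ (z ∈ₗ filter PQ? xs × z ∈ₗ filter P¬Q? xs)
      disjoint {z} (∈PQ , ∈P¬Q) =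
        proj₂ (to (∈-filter⇔ P¬Q? z) ∈P¬Q) (proj₂ (to (∈-filter⇔ PQ? z) ∈PQ))
      P⇔∈ : ∀ z → P z ⇔ z ∈ₗ filter PQ? xs ++ filter P¬Q? xs
      P⇔∈ z = mk⇔ (λ Pz → case Q? z of λ
          { (yes Qz) → ∈-++⁺ˡ (from (∈-filter⇔ PQ? z) (Pz , Qz))
          ; (no ¬Qz) → ∈-++⁺ʳ (filter PQ? xs) (from (∈-filter⇔ P¬Q? z) (Pz , ¬Qz)) })
        λ z∈ → case ∈-++⁻ (filter PQ? xs) z∈ of λ
          { (inj₁ ∈PQ) → proj₁ (to (∈-filter⇔ PQ? z) ∈PQ)
          ; (inj₂ ∈P¬Q) → proj₁ (to (∈-filter⇔ P¬Q? z) ∈P¬Q) }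

  module _ {P Q : A → Set} (P? : Decidable P) (Q? : Decidable Q) where

    count-⊎ : (∀ z → P z → Q z → ⊥) → count (λ z → P? z ⊎-dec Q? z) ≡ count P? + count Q?
    count-⊎ disjoint = trans (count-split (λ z → P? z ⊎-dec Q? z) P?) (cong₂ _+_
      (count-cong _ P? λ z → mk⇔ proj₂ λ Pz → inj₁ Pz , Pz)
      (count-cong _ Q? λ z → mk⇔ (λ { (inj₁ Pz , ¬Pz) → ⊥-elim (¬Pz Pz) ; (inj₂ Qz , _) → Qz })
                                 λ Qz → inj₂ Qz , λ Pz → disjoint z Pz Qz))

  count-involution : {P : A → Set} (P? : Decidable P) (σ : A → A) → (∀ z → σ (σ z) ≡ z) →
                     count P? ≡ count (P? ∘ σ)
  count-involution {P} P? σ σσ = sym (trans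
    (count≡length (P? ∘ σ) (map σ (filter P? xs))
      (Unique.map⁺ σ-injective (Unique.filter⁺ P? xs-unique)) Pσ⇔∈)
    (length-map σ (filter P? xs)))
    where
    σ-injective : ∀ {x y} → σ x ≡ σ y → x ≡ y
    σ-injective {x} {y} σx≡σy = trans (sym (σσ x)) (trans (cong σ σx≡σy) (σσ y))
    Pσ⇔∈ : ∀ z → P (σ z) ⇔ z ∈ₗ map σ (filter P? xs)
    Pσ⇔∈ z = mk⇔
      (λ Pσz → subst (_∈ₗ map σ (filter P? xs)) (σσ z) (∈-map⁺ σ (from (∈-filter⇔ P? (σ z)) Pσz)))
      (λ z∈ → let (y , y∈ , z≡σy) = ∈-map⁻ σ z∈ in
              subst P (sym (trans (cong σ z≡σy) (σσ y))) (to (∈-filter⇔ P? y) y∈))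

-- Exclusive or

≡xor⇔xor≡ : ∀ a b s → (a ≡ b xor s) ⇔ (a xor b ≡ s)
≡xor⇔xor≡ false false s     = mk⇔ id id
≡xor⇔xor≡ false true  false = mk⇔ (λ ()) (λ ())
≡xor⇔xor≡ false true  true  = mk⇔ (λ _ → refl) (λ _ → refl)
≡xor⇔xor≡ true  false s     = mk⇔ id id
≡xor⇔xor≡ true  true  false = mk⇔ (λ _ → refl) (λ _ → refl)
≡xor⇔xor≡ true  true  true  = mk⇔ (λ ()) (λ ())

xor-interchange : ∀ a b c d → (a xor b) xor (c xor d) ≡ (a xor c) xor (b xor d)
xor-interchange = interchange
  where
  open CommutativeSemigroupProperties
         (CommutativeRing.+-commutativeSemigroup xor-∧-commutativeRing)

≢⇒≡not : ∀ {a b} → a ≢ b → a ≡ not b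
≢⇒≡not {false} {false} a≢b = ⊥-elim (a≢b refl)
≢⇒≡not {false} {true}  _   = refl
≢⇒≡not {true}  {false} _   = refl
≢⇒≡not {true}  {true}  a≢b = ⊥-elim (a≢b refl)

xor-true : ∀ b → b xor true ≡ not b
xor-true false = refl
xor-true true  = refl

xor-absorbˡ : ∀ a b → a xor (a xor b) ≡ b
xor-absorbˡ false b = refl
xor-absorbˡ true  b = not-involutive b

xor-involutiveʳ : ∀ a b → (a xor b) xor b ≡ a
xor-involutiveʳ a b = begin
  (a xor b) xor b  ≡⟨ xor-assoc a b b ⟩
  a xor (b xor b)  ≡⟨ cong (a xor_) (xor-same b) ⟩
  a xor false      ≡⟨ xor-identityʳ a ⟩
  a                ∎
  where open ≡-Reasoning

xor-cancelʳ : ∀ a b s → a xor s ≡ b xor s → a ≡ b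
xor-cancelʳ a b s e = trans (sym (xor-involutiveʳ a s)) (trans (cong (_xor s) e) (xor-involutiveʳ b s))

xor-cancelˡ : ∀ s a b → s xor a ≡ s xor b → a ≡ b
xor-cancelˡ s a b e = xor-cancelʳ a b s (trans (xor-comm a s) (trans e (xor-comm s b)))

xor-swapʳ : ∀ a b s → (a xor s) xor b ≡ (a xor b) xor s
xor-swapʳ a b s = begin
  (a xor s) xor b  ≡⟨ xor-assoc a s b ⟩
  a xor (s xor b)  ≡⟨ cong (a xor_) (xor-comm s b) ⟩
  a xor (b xor s)  ≡⟨ xor-assoc a b s ⟨
  (a xor b) xor s  ∎
  where open ≡-Reasoning

≡⇔xor≡false : ∀ a b → (a ≡ b) ⇔ (a xor b ≡ false)
≡⇔xor≡false a b = subst (λ c → (a ≡ c) ⇔ (a xor b ≡ false)) (xor-identityʳ b) (≡xor⇔xor≡ a b false)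

≡false-cong⁻ : ∀ {x y} → (x ≡ false ⇔ y ≡ false) → x ≡ y
≡false-cong⁻ {false} {false} _ = refl
≡false-cong⁻ {false} {true}  x⇔y = sym (to x⇔y refl)
≡false-cong⁻ {true}  {false} x⇔y = from x⇔y refl
≡false-cong⁻ {true}  {true}  _ = refl

≡⇔≡⇒xor≡ : ∀ {a b c d} → (a ≡ b ⇔ c ≡ d) → a xor b ≡ c xor d
≡⇔≡⇒xor≡ {a} {b} {c} {d} ab⇔cd = ≡false-cong⁻ (mk⇔
  (to (≡⇔xor≡false c d) ∘ to ab⇔cd ∘ from (≡⇔xor≡false a b))
  (to (≡⇔xor≡false a b) ∘ from ab⇔cd ∘ from (≡⇔xor≡false c d)))

xor≡⇒≡⇔≡ : ∀ {a b c d} → a xor b ≡ c xor d → (a ≡ b ⇔ c ≡ d)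
xor≡⇒≡⇔≡ {a} {b} {c} {d} e = mk⇔
  (from (≡⇔xor≡false c d) ∘ trans (sym e) ∘ to (≡⇔xor≡false a b))
  (from (≡⇔xor≡false a b) ∘ trans e ∘ to (≡⇔xor≡false c d))

-- The three pairings of a four-element set

bit : Fin 2 → Bool
bit zero       = false
bit (suc zero) = true

bit-injective : ∀ {a b} → bit a ≡ bit b → a ≡ b
bit-injective {zero}     {zero}     _ = refl
bit-injective {suc zero} {suc zero} _ = refl
bit-injective {zero}     {suc zero} ()
bit-injective {suc zero} {zero}     ()

block : Fin 4 → Bool
block = bit ∘ blk

PreservesBlocks : (Fin 4 → Fin 4) → Set
PreservesBlocks π = ∀ i j → block (π i) xor block (π j) ≡ block i xor block j

SeparatesBlocks : (Fin 4 → Fin 4) → Set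
SeparatesBlocks π = ∀ i s t → ∃ λ j → block j ≡ block i xor s × block (π j) ≡ block (π i) xor t

private
  ∀-Bool? : {P : Bool → Set} → (∀ b → Dec (P b)) → Dec (∀ b → P b)
  ∀-Bool? P? = map′ (λ { (Pt , Pf) → λ { true → Pt ; false → Pf } }) (λ P → P true , P false)
                    (P? true ×-dec P? false)

  InjectiveAt : (Fin 4 → Fin 4) → Set
  InjectiveAt π = ∀ i j → π i ≡ π j → i ≡ j

  Dichotomy : (Fin 4 → Fin 4) → Set
  Dichotomy π = InjectiveAt π → PreservesBlocks π ⊎ SeparatesBlocks π

  dichotomy? : ∀ π → Dec (Dichotomy π)
  dichotomy? π =
    (all? λ i → all? λ j → (π i ≟ π j) →-dec (i ≟ j)) →-dec
    ((all? λ i → all? λ j → (block (π i) xor block (π j)) ≟ᵇ (block i xor block j)) ⊎-dec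
     (all? λ i → ∀-Bool? λ s → ∀-Bool? λ t → any? λ j →
        (block j ≟ᵇ (block i xor s)) ×-dec (block (π j) ≟ᵇ (block (π i) xor t))))

  tuple : Fin 4 → Fin 4 → Fin 4 → Fin 4 → Fin 4 → Fin 4
  tuple a b c d = lookup (a ∷ b ∷ c ∷ d ∷ [])

  abstract
    dichotomy-tuples : ∀ a b c d → Dichotomy (tuple a b c d)
    dichotomy-tuples = toWitness {a? = all? λ a → all? λ b → all? λ c → all? λ d →
                                         dichotomy? (tuple a b c d)} tt

  tuple-η : ∀ (π : Fin 4 → Fin 4) i →
            tuple (π zero) (π (suc zero)) (π (suc (suc zero))) (π (suc (suc (suc zero)))) i ≡ π i
  tuple-η π zero                   = refl
  tuple-η π (suc zero)             = refl
  tuple-η π (suc (suc zero))       = refl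
  tuple-η π (suc (suc (suc zero))) = refl

  dichotomy-cong : ∀ {π ρ} → (∀ i → π i ≡ ρ i) → Dichotomy π → Dichotomy ρ
  dichotomy-cong {π} {ρ} π≗ρ dichotomy-π ρ-injective
    with dichotomy-π (λ i j πi≡πj → ρ-injective i j (trans (sym (π≗ρ i)) (trans πi≡πj (π≗ρ j))))
  ... | inj₁ π-preserves = inj₁ λ i j → along-π≗ρ (π-preserves i j)
    where
    along-π≗ρ : ∀ {i j} → block (π i) xor block (π j) ≡ block i xor block j →
                block (ρ i) xor block (ρ j) ≡ block i xor block j
    along-π≗ρ {i} {j} rewrite π≗ρ i | π≗ρ j = id
  ... | inj₂ π-separates = inj₂ λ i s t → let (j , block-j , block-πj) = π-separates i s t in
    j , block-j , along-π≗ρ block-πj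
    where
    along-π≗ρ : ∀ {i j t} → block (π j) ≡ block (π i) xor t → block (ρ j) ≡ block (ρ i) xor t
    along-π≗ρ {i} {j} rewrite π≗ρ i | π≗ρ j = id

-- A permutation of Fin 4 maps the pairing {{0,1},{2,3}} either to itself or to one of the
-- other two pairings, each of which meets it transversally; the check is exhaustive.
preserves-or-separates : ∀ π → Injective _≡_ _≡_ π → PreservesBlocks π ⊎ SeparatesBlocks π
preserves-or-separates π π-inj =
  dichotomy-cong (tuple-η π) (dichotomy-tuples _ _ _ _) λ i j → π-inj

opposite : Fin 4 → Fin 4
opposite zero                   = suc (suc zero)
opposite (suc zero)             = suc (suc (suc zero))
opposite (suc (suc zero))       = zero
opposite (suc (suc (suc zero))) = suc zero

opposite-involutive : ∀ a → opposite (opposite a) ≡ a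
opposite-involutive zero                   = refl
opposite-involutive (suc zero)             = refl
opposite-involutive (suc (suc zero))       = refl
opposite-involutive (suc (suc (suc zero))) = refl

block-opposite : ∀ a → block (opposite a) ≡ not (block a)
block-opposite zero                   = refl
block-opposite (suc zero)             = refl
block-opposite (suc (suc zero))       = refl
block-opposite (suc (suc (suc zero))) = refl

-- Three-element subsets and the edges inside them

∣p∪q∣≤∣p∣+∣q∣ : ∀ {n} (p q : Subset n) → ∣ p ∪ q ∣ ≤ ∣ p ∣ + ∣ q ∣
∣p∪q∣≤∣p∣+∣q∣ []            []            = z≤n
∣p∪q∣≤∣p∣+∣q∣ (outside ∷ p) (outside ∷ q) = ∣p∪q∣≤∣p∣+∣q∣ p q
∣p∪q∣≤∣p∣+∣q∣ (outside ∷ p) (inside  ∷ q) =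
  ℕ.≤-trans (s≤s (∣p∪q∣≤∣p∣+∣q∣ p q)) (ℕ.≤-reflexive (sym (ℕ.+-suc ∣ p ∣ ∣ q ∣)))
∣p∪q∣≤∣p∣+∣q∣ (inside  ∷ p) (t       ∷ q) =
  s≤s (ℕ.≤-trans (∣p∪q∣≤∣p∣+∣q∣ p q) (ℕ.+-monoʳ-≤ ∣ p ∣ (∣p∣≤∣x∷p∣ t q)))

∣p∣≤length : ∀ {n} (p : Subset n) (xs : List (Fin n)) → (∀ {x} → x ∈ p → x ∈ₗ xs) → ∣ p ∣ ≤ length xs
∣p∣≤length {n} p [] p⊆[] rewrite Empty-unique (λ (x , x∈p) → case p⊆[] x∈p of λ ()) =
  ℕ.≤-reflexive (∣⊥∣≡0 n)
∣p∣≤length p (x ∷ xs) p⊆x∷xs = begin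
  ∣ p ∣                ≤⟨ p⊆q⇒∣p∣≤∣q∣ p⊆x∪rest ⟩
  ∣ ⁅ x ⁆ ∪ rest ∣     ≤⟨ ∣p∪q∣≤∣p∣+∣q∣ ⁅ x ⁆ rest ⟩
  ∣ ⁅ x ⁆ ∣ + ∣ rest ∣  ≡⟨ cong (_+ ∣ rest ∣) (∣⁅x⁆∣≡1 x) ⟩
  suc ∣ rest ∣          ≤⟨ s≤s (∣p∣≤length rest xs rest⊆xs) ⟩
  suc (length xs)      ∎
  where
  open ℕ.≤-Reasoning
  rest = p ∩ ∁ ⁅ x ⁆
  p⊆x∪rest : p ⊆ ⁅ x ⁆ ∪ rest
  p⊆x∪rest {y} y∈p with y ≟ x
  ... | yes refl = x∈p∪q⁺ (inj₁ (x∈⁅x⁆ y))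
  ... | no y≢x  = x∈p∪q⁺ (inj₂ (x∈p∩q⁺ (y∈p , x∉p⇒x∈∁p (x≢y⇒x∉⁅y⁆ y≢x))))
  rest⊆xs : ∀ {y} → y ∈ rest → y ∈ₗ xs
  rest⊆xs {y} y∈rest with x∈p∩q⁻ p _ y∈rest
  ... | y∈p , y∈∁x with p⊆x∷xs y∈p
  ...   | here refl  = ⊥-elim (x∈∁p⇒x∉p y∈∁x (x∈⁅x⁆ y))
  ...   | there y∈xs = y∈xs

length≤∣p∣ : ∀ {n} (p : Subset n) {xs : List (Fin n)} → Unique xs → All.All (_∈ p) xs → length xs ≤ ∣ p ∣
length≤∣p∣ p AllPairs.[] All.[] = z≤n
length≤∣p∣ p {x ∷ xs} (x∉xs AllPairs.∷ xs-unique) (x∈p All.∷ xs⊆p) = ℕ.≤-trans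
  (s≤s (length≤∣p∣ (p - x) xs-unique
         (All.zipWith (λ (y∈p , x≢y) → x∈p∧x≢y⇒x∈p-y y∈p (x≢y ∘ sym)) (xs⊆p , x∉xs))))
  (x∈p⇒∣p-x∣<∣p∣ x∈p)

subset : ∀ {m} {P : Fin m → Set} → Decidable P → Subset m
subset P? = tabulate (does ∘ P?)

∈-subset : ∀ {m} {P : Fin m → Set} (P? : Decidable P) W → W ∈ subset P? ⇔ P W
∈-subset {P = P} P? W = mk⇔ to'
  (λ PW → lookup⇒[]= W _ (trans (lookup∘tabulate (does ∘ P?) W) (dec-true (P? W) PW)))
  where
  to' : W ∈ subset P? → P W
  to' W∈ with P? W | trans (sym (lookup∘tabulate (does ∘ P?) W)) ([]=⇒lookup W∈)
  ... | yes PW | _ = PW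

module _ {m} {C : Subset m} (∣C∣≡3 : ∣ C ∣ ≡ 3) where

  third-member : ∀ {A B} → A ∈ C → B ∈ C → ∃ λ D → D ∈ C × D ≢ A × D ≢ B
  third-member {A} {B} A∈C B∈C with any? (λ D → (D ∈? C) ×-dec ¬? (D ≟ A) ×-dec ¬? (D ≟ B))
  ... | yes third = third
  ... | no ¬third = ⊥-elim (ℕ.<-irrefl refl (subst (_≤ 2) ∣C∣≡3 (∣p∣≤length C (A ∷ B ∷ []) C⊆AB)))
    where
    C⊆AB : ∀ {D} → D ∈ C → D ∈ₗ A ∷ B ∷ []
    C⊆AB {D} D∈C with D ≟ A | D ≟ B
    ... | yes refl | _        = here refl
    ... | no _     | yes refl = there (here refl)
    ... | no D≢A   | no D≢B   = ⊥-elim (¬third (D , D∈C , D≢A , D≢B))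

  triangle-members : ∀ {A B D} → A ∈ C → B ∈ C → D ∈ C → A ≢ B → A ≢ D → B ≢ D →
                     ∀ W → W ∈ C ⇔ (W ≡ A ⊎ W ≡ B ⊎ W ≡ D)
  triangle-members {A} {B} {D} A∈C B∈C D∈C A≢B A≢D B≢D W = mk⇔ member
    λ { (inj₁ refl) → A∈C ; (inj₂ (inj₁ refl)) → B∈C ; (inj₂ (inj₂ refl)) → D∈C }
    where
    member : W ∈ C → W ≡ A ⊎ W ≡ B ⊎ W ≡ D
    member W∈C with W ≟ A | W ≟ B | W ≟ D
    ... | yes W≡A | _       | _       = inj₁ W≡A
    ... | no _    | yes W≡B | _       = inj₂ (inj₁ W≡B)
    ... | no _    | no _    | yes W≡D = inj₂ (inj₂ W≡D)
    ... | no W≢A  | no W≢B  | no W≢D  = ⊥-elim (ℕ.<-irrefl refl (subst (4 ≤_) ∣C∣≡3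
      (length≤∣p∣ C ((A≢B All.∷ A≢D All.∷ (W≢A ∘ sym) All.∷ All.[]) AllPairs.∷
                     (B≢D All.∷ (W≢B ∘ sym) All.∷ All.[]) AllPairs.∷
                     ((W≢D ∘ sym) All.∷ All.[]) AllPairs.∷ All.[] AllPairs.∷ AllPairs.[])
                    (A∈C All.∷ B∈C All.∷ D∈C All.∷ W∈C All.∷ All.[]))))

indicator : Bool → ℕ
indicator true  = 1
indicator false = 0

module _ {m : ℕ} where

  private
    pairs : List (Fin m × Fin m)
    pairs = concatMap (λ X → map (λ Y → (X , Y)) (allFin m)) (allFin m)

    pairs≡cartesianProduct : ∀ (xs ys : List (Fin m)) →
                             concatMap (λ X → map (λ Y → (X , Y)) ys) xs ≡ cartesianProduct xs ys
    pairs≡cartesianProduct []       ys = refl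
    pairs≡cartesianProduct (x ∷ xs) ys = cong (map (x ,_) ys ++_) (pairs≡cartesianProduct xs ys)

    pairs-unique : Unique pairs
    pairs-unique = subst Unique (sym (pairs≡cartesianProduct (allFin m) (allFin m)))
                     (Unique.cartesianProduct⁺ (Unique.allFin⁺ m) (Unique.allFin⁺ m))

    pairs-complete : ∀ z → z ∈ₗ pairs
    pairs-complete (X , Y) = subst ((X , Y) ∈ₗ_) (sym (pairs≡cartesianProduct (allFin m) (allFin m)))
                               (∈-cartesianProduct⁺ (∈-allFin X) (∈-allFin Y))

    open Counting pairs pairs-unique pairs-complete

    ordered : Fin m → Fin m → Fin m × Fin m
    ordered X Y with X <? Y
    ... | yes _ = X , Y
    ... | no _  = Y , X

    ordered-< : ∀ {X Y} → X < Y → ordered X Y ≡ (X , Y)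
    ordered-< {X} {Y} X<Y with X <? Y
    ... | yes _   = refl
    ... | no X≮Y = ⊥-elim (X≮Y X<Y)

    ordered-> : ∀ {X Y} → Y < X → ordered X Y ≡ (Y , X)
    ordered-> {X} {Y} Y<X with X <? Y
    ... | yes X<Y = ⊥-elim (<-asym X<Y Y<X)
    ... | no _    = refl

    ordered-injective : ∀ {X Y X' Y'} → ordered X Y ≡ ordered X' Y' →
                        (X ≡ X' × Y ≡ Y') ⊎ (X ≡ Y' × Y ≡ X')
    ordered-injective {X} {Y} {X'} {Y'} e with X <? Y | X' <? Y'
    ... | yes _ | yes _ = inj₁ (×-≡,≡←≡ e)
    ... | yes _ | no _  = inj₂ (×-≡,≡←≡ e)
    ... | no _  | yes _ = let (Y≡X' , X≡Y') = ×-≡,≡←≡ e in inj₂ (X≡Y' , Y≡X')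
    ... | no _  | no _  = let (Y≡Y' , X≡X') = ×-≡,≡←≡ e in inj₁ (X≡X' , Y≡Y')

  module _ (S : Fin m → Fin m → Bool) (S-sym : ∀ X Y → S X Y ≡ S Y X) where

    private
      EdgeAt : Fin m → Fin m → Fin m × Fin m → Set
      EdgeAt X Y z = z ≡ ordered X Y × S X Y ≡ true

      edgeAt? : ∀ X Y → Decidable (EdgeAt X Y)
      edgeAt? X Y z = ≡-dec _≟_ _≟_ z (ordered X Y) ×-dec (S X Y ≟ᵇ true)

      count-edgeAt : ∀ X Y → count (edgeAt? X Y) ≡ indicator (S X Y)
      count-edgeAt X Y = count-at (S X Y) refl
        where
        count-at : ∀ b → S X Y ≡ b → count (edgeAt? X Y) ≡ indicator b
        count-at true  SXY = count≡1 (edgeAt? X Y) (ordered X Y) λ z → mk⇔ proj₁ (λ z≡ → z≡ , SXY)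
        count-at false SXY = count≡0 (edgeAt? X Y)
          λ { z (_ , SXY≡true) → case trans (sym SXY) SXY≡true of λ () }

      edgeAt-disjoint : ∀ {X Y X' Y'} → ¬ (X ≡ X' × Y ≡ Y') → ¬ (X ≡ Y' × Y ≡ X') →
                        ∀ z → EdgeAt X Y z → EdgeAt X' Y' z → ⊥
      edgeAt-disjoint ¬same ¬swapped z (z≡ , _) (z≡' , _) with ordered-injective (trans (sym z≡) z≡')
      ... | inj₁ same    = ¬same same
      ... | inj₂ swapped = ¬swapped swapped

      edge⇒edgeAt : ∀ {X Y X' Y'} → X' < Y' → (X' ≡ X × Y' ≡ Y) ⊎ (X' ≡ Y × Y' ≡ X) →
                    S X' Y' ≡ true → EdgeAt X Y (X' , Y')
      edge⇒edgeAt X'<Y' (inj₁ (refl , refl)) S≡true = sym (ordered-< X'<Y') , S≡true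
      edge⇒edgeAt X'<Y' (inj₂ (refl , refl)) S≡true = sym (ordered-> X'<Y') , trans (S-sym _ _) S≡true

      edgeAt⇒edge : ∀ {X Y X' Y'} → X ≢ Y → EdgeAt X Y (X' , Y') →
                    X' < Y' × ((X' ≡ X × Y' ≡ Y) ⊎ (X' ≡ Y × Y' ≡ X)) × S X' Y' ≡ true
      edgeAt⇒edge {X} {Y} X≢Y (z≡ , S≡true) with <-cmp X Y
      ... | tri< X<Y _ _ with refl , refl ← ×-≡,≡←≡ (trans z≡ (ordered-< X<Y)) =
        X<Y , inj₁ (refl , refl) , S≡true
      ... | tri≈ _ X≡Y _ = ⊥-elim (X≢Y X≡Y)
      ... | tri> _ _ Y<X with refl , refl ← ×-≡,≡←≡ (trans z≡ (ordered-> Y<X)) =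
        Y<X , inj₂ (refl , refl) , trans (S-sym _ _) S≡true

    edgeCount-triangle : ∀ {C A B D} → A ≢ B → A ≢ D → B ≢ D → (∀ W → W ∈ C ⇔ (W ≡ A ⊎ W ≡ B ⊎ W ≡ D)) →
                         edgeCount S C ≡ indicator (S A B) + (indicator (S A D) + indicator (S B D))
    edgeCount-triangle {C} {A} {B} {D} A≢B A≢D B≢D C⇔ABD = begin
      edgeCount S C
        ≡⟨ count-cong _ triangle? (λ (X' , Y') → edge⇔ X' Y') ⟩
      count triangle?
        ≡⟨ count-⊎ (edgeAt? A B) _ AB-disjoint ⟩
      count (edgeAt? A B) + count (λ z → edgeAt? A D z ⊎-dec edgeAt? B D z)
        ≡⟨ cong (count (edgeAt? A B) +_) (count-⊎ (edgeAt? A D) (edgeAt? B D) AD-BD-disjoint) ⟩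
      count (edgeAt? A B) + (count (edgeAt? A D) + count (edgeAt? B D))
        ≡⟨ cong₂ _+_ (count-edgeAt A B) (cong₂ _+_ (count-edgeAt A D) (count-edgeAt B D)) ⟩
      indicator (S A B) + (indicator (S A D) + indicator (S B D))
        ∎
      where
      open ≡-Reasoning
      triangle? = λ z → edgeAt? A B z ⊎-dec (edgeAt? A D z ⊎-dec edgeAt? B D z)
      AD-BD-disjoint = edgeAt-disjoint (λ (A≡B , _) → A≢B A≡B) (λ (A≡D , _) → A≢D A≡D)
      AB-disjoint : ∀ z → EdgeAt A B z → EdgeAt A D z ⊎ EdgeAt B D z → ⊥
      AB-disjoint z AB (inj₁ AD) =
        edgeAt-disjoint (λ (_ , B≡D) → B≢D B≡D) (λ (A≡D , _) → A≢D A≡D) z AB AD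
      AB-disjoint z AB (inj₂ BD) =
        edgeAt-disjoint (λ (A≡B , _) → A≢B A≡B) (λ (A≡D , _) → A≢D A≡D) z AB BD
      edge⇔ : ∀ X' Y' → (X' < Y' × X' ∈ C × Y' ∈ C × S X' Y' ≡ true) ⇔
                        (EdgeAt A B (X' , Y') ⊎ EdgeAt A D (X' , Y') ⊎ EdgeAt B D (X' , Y'))
      edge⇔ X' Y' = mk⇔ to' from'
        where
        to' : X' < Y' × X' ∈ C × Y' ∈ C × S X' Y' ≡ true →
              EdgeAt A B (X' , Y') ⊎ EdgeAt A D (X' , Y') ⊎ EdgeAt B D (X' , Y')
        to' (X'<Y' , X'∈C , Y'∈C , S≡true) = classify (to (C⇔ABD X') X'∈C) (to (C⇔ABD Y') Y'∈C)
          where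
          sorted : ∀ {X Y} → X' ≡ X → Y' ≡ Y → EdgeAt X Y (X' , Y')
          sorted X'≡X Y'≡Y = edge⇒edgeAt X'<Y' (inj₁ (X'≡X , Y'≡Y)) S≡true
          reversed : ∀ {X Y} → Y' ≡ X → X' ≡ Y → EdgeAt X Y (X' , Y')
          reversed Y'≡X X'≡Y = edge⇒edgeAt X'<Y' (inj₂ (X'≡Y , Y'≡X)) S≡true
          loop : ∀ {X} → X' ≡ X → Y' ≡ X → ⊥
          loop X'≡X Y'≡X = <-irrefl (trans X'≡X (sym Y'≡X)) X'<Y'
          classify : X' ≡ A ⊎ X' ≡ B ⊎ X' ≡ D → Y' ≡ A ⊎ Y' ≡ B ⊎ Y' ≡ D →
                     EdgeAt A B (X' , Y') ⊎ EdgeAt A D (X' , Y') ⊎ EdgeAt B D (X' , Y')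
          classify (inj₁ X'≡A)        (inj₁ Y'≡A)        = ⊥-elim (loop X'≡A Y'≡A)
          classify (inj₁ X'≡A)        (inj₂ (inj₁ Y'≡B)) = inj₁ (sorted X'≡A Y'≡B)
          classify (inj₁ X'≡A)        (inj₂ (inj₂ Y'≡D)) = inj₂ (inj₁ (sorted X'≡A Y'≡D))
          classify (inj₂ (inj₁ X'≡B)) (inj₁ Y'≡A)        = inj₁ (reversed Y'≡A X'≡B)
          classify (inj₂ (inj₁ X'≡B)) (inj₂ (inj₁ Y'≡B)) = ⊥-elim (loop X'≡B Y'≡B)
          classify (inj₂ (inj₁ X'≡B)) (inj₂ (inj₂ Y'≡D)) = inj₂ (inj₂ (sorted X'≡B Y'≡D))
          classify (inj₂ (inj₂ X'≡D)) (inj₁ Y'≡A)        = inj₂ (inj₁ (reversed Y'≡A X'≡D))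
          classify (inj₂ (inj₂ X'≡D)) (inj₂ (inj₁ Y'≡B)) = inj₂ (inj₂ (reversed Y'≡B X'≡D))
          classify (inj₂ (inj₂ X'≡D)) (inj₂ (inj₂ Y'≡D)) = ⊥-elim (loop X'≡D Y'≡D)
        from-edge : ∀ {X Y} → X ∈ C → Y ∈ C → X ≢ Y → EdgeAt X Y (X' , Y') →
                    X' < Y' × X' ∈ C × Y' ∈ C × S X' Y' ≡ true
        from-edge X∈C Y∈C X≢Y e with edgeAt⇒edge X≢Y e
        ... | X'<Y' , inj₁ (refl , refl) , S≡true = X'<Y' , X∈C , Y∈C , S≡true
        ... | X'<Y' , inj₂ (refl , refl) , S≡true = X'<Y' , Y∈C , X∈C , S≡true
        A∈C = from (C⇔ABD A) (inj₁ refl)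
        B∈C = from (C⇔ABD B) (inj₂ (inj₁ refl))
        D∈C = from (C⇔ABD D) (inj₂ (inj₂ refl))
        from' : EdgeAt A B (X' , Y') ⊎ EdgeAt A D (X' , Y') ⊎ EdgeAt B D (X' , Y') →
                X' < Y' × X' ∈ C × Y' ∈ C × S X' Y' ≡ true
        from' (inj₁ e)        = from-edge A∈C B∈C A≢B e
        from' (inj₂ (inj₁ e)) = from-edge A∈C D∈C A≢D e
        from' (inj₂ (inj₂ e)) = from-edge B∈C D∈C B≢D e

-- Blocks of fibers and interspaces of type 2K_{2,2}

module Configuration {n m} (𝒞 : CoherentConfiguration n m) where
  open CoherentConfiguration 𝒞
  open Counting (allFin n) (Unique.allFin⁺ n) ∈-allFin public

  Path : Fin n → Fin n → Fin m → Fin m → Fin n → Set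
  Path u v R S w = col u w ≡ R × col w v ≡ S

  path? : ∀ u v R S → Decidable (Path u v R S)
  path? u v R S w = (col u w ≟ R) ×-dec (col w v ≟ S)

  p≡count : ∀ u v R S → p (col u v) R S ≡ count (path? u v R S)
  p≡count u v R S = sym (coh u v R S)

  count-path-cong : ∀ {u v u' v'} R S → col u v ≡ col u' v' →
                    count (path? u v R S) ≡ count (path? u' v' R S)
  count-path-cong {u} {v} {u'} {v'} R S uv≡u'v' =
    trans (coh u v R S) (trans (cong (λ T → p T R S) uv≡u'v') (p≡count u' v' R S))

  -- The path u → u → v is transported to (u', v'), and by (A) its first step is the loop at u'.
  source-fiber : ∀ {u v u' v'} → col u v ≡ col u' v' → col u u ≡ col u' u'
  source-fiber {u} {v} {u'} {v'} uv≡u'v'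
    with w , u'w≡uu , _ ← count≢0⇒∃ (path? u' v' (col u u) (col u v))
           (count≢0 (path? u v _ _) u (refl , refl) ∘ trans (count-path-cong _ _ uv≡u'v')) 
    with refl ← loops u u' w (sym u'w≡uu) = sym u'w≡uu

  target-fiber : ∀ {u v u' v'} → col u v ≡ col u' v' → col v v ≡ col v' v'
  target-fiber {u} {v} {u'} {v'} uv≡u'v'
    with w , _ , wv'≡vv ← count≢0⇒∃ (path? u' v' (col u v) (col v v))
           (count≢0 (path? u v _ _) v (refl , refl) ∘ trans (count-path-cong _ _ uv≡u'v'))
    with refl ← loops v w v' (sym wv'≡vv) = sym wv'≡vv

  uniform-col : ∀ {X Y x y x' y'} → Uniform 𝒞 X Y →
                col x x ≡ X → col y y ≡ Y → col x' x' ≡ X → col y' y' ≡ Y → col x y ≡ col x' y'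
  uniform-col {x = x} {y} {x'} {y'} (R , R⇔X×Y) x∈X y∈Y x'∈X y'∈Y =
    trans (from (R⇔X×Y x y) (x∈X , y∈Y)) (sym (from (R⇔X×Y x' y') (x'∈X , y'∈Y)))

  uniform-sym : ∀ {X Y} → Uniform 𝒞 X Y → Uniform 𝒞 Y X
  uniform-sym (R , R⇔X×Y) = proj₁ (transp R) , λ u v → mk⇔
    (λ vuR → let (v∈X , u∈Y) = to (R⇔X×Y v u) (from (proj₂ (transp R) v u) vuR) in u∈Y , v∈X)
    (λ (u∈Y , v∈X) → to (proj₂ (transp R) v u) (from (R⇔X×Y v u) (v∈X , u∈Y)))

  nonUniform-sym : ∀ {X Y} → NonUniform 𝒞 X Y → NonUniform 𝒞 Y X
  nonUniform-sym (X-fiber , Y-fiber , X≢Y , ¬uniform) =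
    Y-fiber , X-fiber , X≢Y ∘ sym , ¬uniform ∘ uniform-sym

  record Enumeration (X : Fin m) : Set where
    field
      point           : Fin 4 → Fin n
      point-injective : Injective _≡_ _≡_ point
      point-∈         : ∀ a → col (point a) (point a) ≡ X
      point-onto      : ∀ x → col x x ≡ X → ∃ λ a → point a ≡ x

  module _ {X : Fin m} (e : Enumeration X) where
    open Enumeration e

    -- false is a junk value outside X
    blockOf : Fin n → Bool
    blockOf x with col x x ≟ X
    ... | yes x∈X = block (proj₁ (point-onto x x∈X))
    ... | no _    = false

    blockOf-point : ∀ a → blockOf (point a) ≡ block a
    blockOf-point a with col (point a) (point a) ≟ X
    ... | yes a∈X = cong block (point-injective (proj₂ (point-onto (point a) a∈X)))
    ... | no a∉X  = ⊥-elim (a∉X (point-∈ a))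

    point-in-block : ∀ k → ∃ λ x → col x x ≡ X × blockOf x ≡ k
    point-in-block false = point zero , point-∈ zero , blockOf-point zero
    point-in-block true  = point (suc (suc zero)) , point-∈ _ , blockOf-point (suc (suc zero))

    swap : Fin n → Fin n
    swap x with col x x ≟ X
    ... | yes x∈X = point (opposite (proj₁ (point-onto x x∈X)))
    ... | no _    = x

    swap-outside : ∀ x → col x x ≢ X → swap x ≡ x
    swap-outside x x∉X with col x x ≟ X
    ... | yes x∈X = ⊥-elim (x∉X x∈X)
    ... | no _    = refl

    swap-point : ∀ a → swap (point a) ≡ point (opposite a)
    swap-point a with col (point a) (point a) ≟ X
    ... | yes a∈X = cong (point ∘ opposite) (point-injective (proj₂ (point-onto (point a) a∈X)))
    ... | no a∉X  = ⊥-elim (a∉X (point-∈ a))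

    swap-∈ : ∀ {x} → col x x ≡ X → col (swap x) (swap x) ≡ X × blockOf (swap x) ≡ not (blockOf x)
    swap-∈ {x} x∈X with a , refl ← point-onto x x∈X rewrite swap-point a =
      point-∈ (opposite a) ,
      trans (blockOf-point (opposite a)) (trans (block-opposite a) (cong not (sym (blockOf-point a))))

    swap-involutive : ∀ x → swap (swap x) ≡ x
    swap-involutive x = by-membership (col x x ≟ X)
      where
      by-membership : Dec (col x x ≡ X) → swap (swap x) ≡ x
      by-membership (no x∉X) rewrite swap-outside x x∉X = swap-outside x x∉X
      by-membership (yes x∈X) with a , refl ← point-onto x x∈X =
        trans (cong swap (swap-point a))
              (trans (swap-point (opposite a)) (cong point (opposite-involutive a)))

    block-size : ∀ k → count (λ w → (col w w ≟ X) ×-dec (blockOf w ≟ᵇ k)) ≡ 2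
    block-size k = count≡length _ (point (first k) ∷ point (second k) ∷ [])
      ((point-injective-≢ (first≢second k) All.∷ All.[]) AllPairs.∷ (All.[] AllPairs.∷ AllPairs.[]))
      λ w → mk⇔ (λ (w∈X , bw≡k) → in-block (point-onto w w∈X) bw≡k) out-block
      where
      first second : Bool → Fin 4
      first false = zero
      first true = suc (suc zero)
      second false = suc zero
      second true = suc (suc (suc zero))
      first≢second : ∀ k → first k ≢ second k
      first≢second false ()
      first≢second true ()
      point-injective-≢ : ∀ {a b} → a ≢ b → point a ≢ point b
      point-injective-≢ a≢b = a≢b ∘ point-injective
      block-first : ∀ k → block (first k) ≡ k
      block-first false = refl
      block-first true = refl
      block-second : ∀ k → block (second k) ≡ k
      block-second false = refl
      block-second true = refl
      in-block : ∀ {w} → ∃ (λ a → point a ≡ w) → blockOf w ≡ k →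
                 w ∈ₗ point (first k) ∷ point (second k) ∷ []
      in-block (a , refl) ba≡k = members a k (trans (sym (blockOf-point a)) ba≡k)
        where
        members : ∀ a k → block a ≡ k → point a ∈ₗ point (first k) ∷ point (second k) ∷ []
        members zero                   false _ = here refl
        members (suc zero)             false _ = there (here refl)
        members (suc (suc zero))       true  _ = here refl
        members (suc (suc (suc zero))) true  _ = there (here refl)
      out-block : ∀ {w} → w ∈ₗ point (first k) ∷ point (second k) ∷ [] → col w w ≡ X × blockOf w ≡ k
      out-block (here refl)         = point-∈ _ , trans (blockOf-point _) (block-first k)
      out-block (there (here refl)) = point-∈ _ , trans (blockOf-point _) (block-second k)

  AgreeOn : Fin m → (Fin n → Bool) → (Fin n → Bool) → Set
  AgreeOn X β β' = ∀ {x x'} → col x x ≡ X → col x' x' ≡ X → β x xor β x' ≡ β' x xor β' x'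

  SeparateOn : Fin m → (Fin n → Bool) → (Fin n → Bool) → Set
  SeparateOn X β β' = ∀ {x} → col x x ≡ X → ∀ s t →
                      ∃ λ x' → col x' x' ≡ X × β x' ≡ β x xor s × β' x' ≡ β' x xor t

  module _ {X : Fin m} {β β' : Fin n → Bool} where

    agree-shift : AgreeOn X β β' → ∀ {x x' s} → col x x ≡ X → col x' x' ≡ X →
                  β x' ≡ β x xor s → β' x' ≡ β' x xor s
    agree-shift β~β' x∈X x'∈X shifted =
      from (≡xor⇔xor≡ _ _ _) (trans (sym (β~β' x'∈X x∈X)) (to (≡xor⇔xor≡ _ _ _) shifted))

    agree-sym : AgreeOn X β β' → AgreeOn X β' β
    agree-sym β~β' x∈X x'∈X = sym (β~β' x∈X x'∈X)

  agree-trans : ∀ {X β β' β''} → AgreeOn X β β' → AgreeOn X β' β'' → AgreeOn X β β''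
  agree-trans β~β' β'~β'' x∈X x'∈X = trans (β~β' x∈X x'∈X) (β'~β'' x∈X x'∈X)

  module _ {X : Fin m} (e e' : Enumeration X) where
    open Enumeration

    private
      π : Fin 4 → Fin 4
      π i = proj₁ (point-onto e' (point e i) (point-∈ e i))

      point-π : ∀ i → point e' (π i) ≡ point e i
      point-π i = proj₂ (point-onto e' (point e i) (point-∈ e i))

      π-injective : Injective _≡_ _≡_ π
      π-injective {i} {j} πi≡πj =
        point-injective e (trans (sym (point-π i)) (trans (cong (point e') πi≡πj) (point-π j)))

      blockOf-e'-point : ∀ i → blockOf e' (point e i) ≡ block (π i)
      blockOf-e'-point i = trans (cong (blockOf e') (sym (point-π i))) (blockOf-point e' (π i))

    agree-or-separate : AgreeOn X (blockOf e) (blockOf e') ⊎ SeparateOn X (blockOf e) (blockOf e')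
    agree-or-separate with preserves-or-separates π π-injective
    ... | inj₁ π-preserves = inj₁ λ x∈X x'∈X → agree (point-onto e _ x∈X) (point-onto e _ x'∈X)
      where
      agree : ∀ {x x'} → ∃ (λ i → point e i ≡ x) → ∃ (λ j → point e j ≡ x') →
              blockOf e x xor blockOf e x' ≡ blockOf e' x xor blockOf e' x'
      agree (i , refl) (j , refl)
        rewrite blockOf-point e i | blockOf-point e j | blockOf-e'-point i | blockOf-e'-point j =
        sym (π-preserves i j)
    ... | inj₂ π-separates = inj₂ λ x∈X s t → separate (point-onto e _ x∈X) s t
      where
      separate : ∀ {x} → ∃ (λ i → point e i ≡ x) → ∀ s t → ∃ λ x' → col x' x' ≡ X ×
                 blockOf e x' ≡ blockOf e x xor s × blockOf e' x' ≡ blockOf e' x xor t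
      separate (i , refl) s t with j , block-j , block-πj ← π-separates i s t =
        point e j , point-∈ e j ,
        trans (blockOf-point e j) (trans block-j (cong (_xor s) (sym (blockOf-point e i)))) ,
        trans (blockOf-e'-point j) (trans block-πj (cong (_xor t) (sym (blockOf-e'-point i))))

  module Interspace {A B : Fin m} (t : Type2K22 𝒞 A B) where
    open Type2K22 t

    left : Enumeration A
    left = record { point = ex ; point-injective = ex-inj ; point-∈ = ex-in ; point-onto = ex-all }

    right : Enumeration B
    right = record { point = ey ; point-injective = ey-inj ; point-∈ = ey-in ; point-onto = ey-all }

    βˡ βʳ : Fin n → Bool
    βˡ = blockOf left
    βʳ = blockOf right

    -- the argument says whether the blocks of x and y differ
    rel : Bool → Fin m
    rel false = r
    rel true  = r'

    col-points : ∀ a b → col (ex a) (ey b) ≡ rel (block a xor block b)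
    col-points a b with blk a ≟ blk b
    ... | yes same = subst (λ c → col (ex a) (ey b) ≡ rel c)
                       (sym (to (≡⇔xor≡false _ _) (cong bit same)))
                       (from (r-spec _ _) (a , b , refl , refl , same))
    ... | no differ = subst (λ c → col (ex a) (ey b) ≡ rel c)
                        (sym (trans (cong (_xor block b) (≢⇒≡not (differ ∘ bit-injective)))
                                    (xor-inverseˡ (block b))))
                        (from (r'-spec _ _) (a , b , refl , refl , differ))

    col≡rel : ∀ {x y} → col x x ≡ A → col y y ≡ B → col x y ≡ rel (βˡ x xor βʳ y)
    col≡rel x∈A y∈B with a , refl ← ex-all _ x∈A | b , refl ← ey-all _ y∈B
      rewrite blockOf-point left a | blockOf-point right b = col-points a b

    r≢r' : r ≢ r'
    r≢r' r≡r' with to (r-spec _ _) (trans (col-points zero (suc (suc zero))) (sym r≡r'))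
    ... | _ , _ , x≡ , y≡ , same with ex-inj x≡ | ey-inj y≡
    ... | refl | refl = case same of λ ()

    rel-injective : ∀ {b c} → rel b ≡ rel c → b ≡ c
    rel-injective {false} {false} _ = refl
    rel-injective {true}  {true}  _ = refl
    rel-injective {false} {true}  e = ⊥-elim (r≢r' e)
    rel-injective {true}  {false} e = ⊥-elim (r≢r' (sym e))

    col≡col⇔ : ∀ {x y x' y'} → col x x ≡ A → col y y ≡ B → col x' x' ≡ A → col y' y' ≡ B →
               (col x y ≡ col x' y') ⇔ (βˡ x xor βʳ y ≡ βˡ x' xor βʳ y')
    col≡col⇔ x∈A y∈B x'∈A y'∈B = mk⇔
      (λ e → rel-injective (trans (sym (col≡rel x∈A y∈B)) (trans e (col≡rel x'∈A y'∈B))))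
      (λ e → trans (col≡rel x∈A y∈B) (trans (cong rel e) (sym (col≡rel x'∈A y'∈B))))

    rel-⊆ : ∀ b {u v} → col u v ≡ rel b → col u u ≡ A × col v v ≡ B
    rel-⊆ false uvR with a , b , refl , refl , _ ← to (r-spec _ _) uvR = ex-in a , ey-in b
    rel-⊆ true uvR' with a , b , refl , refl , _ ← to (r'-spec _ _) uvR' = ex-in a , ey-in b

    fiberˡ : IsFiber 𝒞 A
    fiberˡ = ex zero , ex-in zero

    fiberʳ : IsFiber 𝒞 B
    fiberʳ = ey zero , ey-in zero

    same-blockʳ⇔same-column : ∀ {y y'} → col y y ≡ B → col y' y' ≡ B →
                              (βʳ y ≡ βʳ y') ⇔ (∀ {w} → col w w ≡ A → col w y ≡ col w y')
    same-blockʳ⇔same-column {y} {y'} y∈B y'∈B = mk⇔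
      (λ same {w} w∈A → from (col≡col⇔ w∈A y∈B w∈A y'∈B) (cong (βˡ w xor_) same))
      (λ same-column → xor-cancelˡ (βˡ (ex zero)) (βʳ y) (βʳ y')
         (to (col≡col⇔ (ex-in zero) y∈B (ex-in zero) y'∈B) (same-column (ex-in zero))))

    detRel⇔same-blockʳ : ∀ y y' → detRel 𝒞 t y y' ⇔ (col y y ≡ B × col y' y' ≡ B × y ≢ y' × βʳ y ≡ βʳ y')
    detRel⇔same-blockʳ y y' = mk⇔
      (λ { (a , b , refl , refl , a≢b , same) →
           ey-in a , ey-in b , a≢b ∘ ey-inj ,
           trans (blockOf-point right a) (trans (cong bit same) (sym (blockOf-point right b))) })
      (λ (y∈B , y'∈B , y≢y' , same) → fromBlocks (ey-all y y∈B) (ey-all y' y'∈B) y≢y' same)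
      where
      fromBlocks : ∀ {y y'} → ∃ (λ a → ey a ≡ y) → ∃ (λ b → ey b ≡ y') → y ≢ y' → βʳ y ≡ βʳ y' →
                   detRel 𝒞 t y y'
      fromBlocks (a , refl) (b , refl) y≢y' same =
        a , b , refl , refl , y≢y' ∘ cong ey ,
        bit-injective (trans (sym (blockOf-point right a)) (trans same (blockOf-point right b)))

  transpose : ∀ {A B} → Type2K22 𝒞 A B → Type2K22 𝒞 B A
  transpose t = record
    { ex = ey ; ey = ex ; ex-inj = ey-inj ; ey-inj = ex-inj
    ; ex-in = ey-in ; ey-in = ex-in ; ex-all = ey-all ; ey-all = ex-all
    ; r = proj₁ (transp r) ; r' = proj₁ (transp r')
    ; r-spec = λ u v → mk⇔
        (λ vur → let (a , b , v≡ , u≡ , same) = to (r-spec v u) (from (proj₂ (transp r) v u) vur)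
                 in b , a , u≡ , v≡ , sym same)
        (λ (a , b , u≡ , v≡ , same) →
           to (proj₂ (transp r) v u) (from (r-spec v u) (b , a , v≡ , u≡ , sym same)))
    ; r'-spec = λ u v → mk⇔
        (λ vur' → let (a , b , v≡ , u≡ , differ) = to (r'-spec v u) (from (proj₂ (transp r') v u) vur')
                  in b , a , u≡ , v≡ , differ ∘ sym)
        (λ (a , b , u≡ , v≡ , differ) →
           to (proj₂ (transp r') v u) (from (r'-spec v u) (b , a , v≡ , u≡ , differ ∘ sym)))
    }
    where open Type2K22 t

  open Interspace public using () renaming (βʳ to βʳ[_])

  agree-records : ∀ {A B} (t t' : Type2K22 𝒞 A B) → AgreeOn B βʳ[ t ] βʳ[ t' ]
  agree-records t t' y∈B y'∈B =
    ≡⇔≡⇒xor≡ (mk⇔ (from (columns t') ∘ to (columns t)) (from (columns t) ∘ to (columns t')))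
    where columns = λ t → Interspace.same-blockʳ⇔same-column t y∈B y'∈B

  agree⇒directlyConnected : ∀ {Y Z X} (t₁ : Type2K22 𝒞 Y X) (t₂ : Type2K22 𝒞 Z X) →
                            AgreeOn X βʳ[ t₁ ] βʳ[ t₂ ] → DirectlyConnected 𝒞 Y Z X
  agree⇒directlyConnected t₁ t₂ t₁~t₂ = t₁ , t₂ , λ x x' → mk⇔
    (λ d → let (x∈X , x'∈X , x≢x' , same) = to (detRel⇔ t₁ x x') d in
           from (detRel⇔ t₂ x x') (x∈X , x'∈X , x≢x' , to (xor≡⇒≡⇔≡ (t₁~t₂ x∈X x'∈X)) same))
    (λ d → let (x∈X , x'∈X , x≢x' , same) = to (detRel⇔ t₂ x x') d in
           from (detRel⇔ t₁ x x') (x∈X , x'∈X , x≢x' , from (xor≡⇒≡⇔≡ (t₁~t₂ x∈X x'∈X)) same))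
    where detRel⇔ = Interspace.detRel⇔same-blockʳ

  directlyConnected⇒agree : ∀ {Y Z X} → DirectlyConnected 𝒞 Y Z X →
                            (t₁ : Type2K22 𝒞 Y X) (t₂ : Type2K22 𝒞 Z X) → AgreeOn X βʳ[ t₁ ] βʳ[ t₂ ]
  directlyConnected⇒agree (t₁' , t₂' , detRel⇔detRel) t₁ t₂ =
    agree-trans {β = βʳ[ t₁ ]} {βʳ[ t₁' ]} {βʳ[ t₂ ]} (agree-records t₁ t₁')
      (agree-trans {β = βʳ[ t₁' ]} {βʳ[ t₂' ]} {βʳ[ t₂ ]} t₁'~t₂' (agree-records t₂' t₂))
    where
    detRel⇔ = Interspace.detRel⇔same-blockʳ
    t₁'~t₂' : AgreeOn _ βʳ[ t₁' ] βʳ[ t₂' ]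
    t₁'~t₂' {x} {x'} x∈X x'∈X with x ≟ x'
    ... | yes refl = trans (xor-same (βʳ[ t₁' ] x)) (sym (xor-same (βʳ[ t₂' ] x)))
    ... | no x≢x' = ≡⇔≡⇒xor≡ (mk⇔
      (λ same → proj₂ (proj₂ (proj₂ (to (detRel⇔ t₂' x x')
                  (to (detRel⇔detRel x x') (from (detRel⇔ t₁' x x') (x∈X , x'∈X , x≢x' , same)))))))
      (λ same → proj₂ (proj₂ (proj₂ (to (detRel⇔ t₁' x x')
                  (from (detRel⇔detRel x x') (from (detRel⇔ t₂' x x') (x∈X , x'∈X , x≢x' , same))))))))

  module Flip (S : Fin m → Fin m → Bool) (S-edges : IsEdgeSet 𝒞 S)
              (f : Fin m → Fin m) (f-S : IsFS 𝒞 S f) where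

    S-sym : ∀ X Y → S X Y ≡ S Y X
    S-sym = proj₁ S-edges

    S⇒nonUniform : ∀ {X Y} → S X Y ≡ true → NonUniform 𝒞 X Y
    S⇒nonUniform = proj₂ S-edges _ _

    S-irrefl : ∀ X → S X X ≡ false
    S-irrefl X with S X X in SXX
    ... | true  = ⊥-elim (proj₁ (proj₂ (proj₂ (S⇒nonUniform SXX))) refl)
    ... | false = refl

    uniform⇒S≡false : ∀ {X Y} → Uniform 𝒞 X Y → S X Y ≡ false
    uniform⇒S≡false {X} {Y} uniform with S X Y in SXY
    ... | true  = ⊥-elim (proj₂ (proj₂ (proj₂ (S⇒nonUniform SXY))) uniform)
    ... | false = refl

    private
      f-S-col : ∀ a b →
                (S (col a a) (col b b) ≡ true →
                 f (col a b) ≢ col a b × InRel 𝒞 (f (col a b)) (col a a) (col b b)) ×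
                (S (col a a) (col b b) ≡ false → f (col a b) ≡ col a b)
      f-S-col a b = f-S (col a b) (col a a) (col b b) (a , refl) (b , refl)
                        λ u v uv≡ab → source-fiber uv≡ab , target-fiber uv≡ab

    f-fixed : ∀ {a b} → S (col a a) (col b b) ≡ false → f (col a b) ≡ col a b
    f-fixed {a} {b} = proj₂ (f-S-col a b)

    f-cell : ∀ {a b} → col a a ≡ col b b → f (col a b) ≡ col a b
    f-cell {a} a∼b = f-fixed (trans (cong (S (col a a)) (sym a∼b)) (S-irrefl (col a a)))

    f-fixed-at : ∀ {a b X Y} → col a a ≡ X → col b b ≡ Y → S X Y ≡ false → f (col a b) ≡ col a b
    f-fixed-at a∈X b∈Y SXY = f-fixed (trans (cong₂ S a∈X b∈Y) SXY)

    f-col-fibers : ∀ {a b a' b'} → col a' b' ≡ f (col a b) → col a a ≡ col a' a' × col b b ≡ col b' b'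
    f-col-fibers {a} {b} {a'} {b'} a'b'≡fab with S (col a a) (col b b) in SAB | f-S-col a b
    ... | true  | flipped , _ =
      let (a'∈ , b'∈) = proj₂ (flipped refl) a' b' a'b'≡fab in sym a'∈ , sym b'∈
    ... | false | _ , fixed = let ab≡a'b' = sym (trans a'b'≡fab (fixed refl)) in
                              source-fiber ab≡a'b' , target-fiber ab≡a'b'

    RowsMatch : Fin m → Fin n → Fin n → Set
    RowsMatch R u u' = ∀ w → (col u' w ≡ f R) ⇔ (col u w ≡ R)

    ColumnsMatch : Fin m → Fin n → Fin n → Set
    ColumnsMatch R v v' = ∀ w → (col w v' ≡ f R) ⇔ (col w v ≡ R)

    rowsMatch-refl : ∀ {R} u → f R ≡ R → RowsMatch R u u
    rowsMatch-refl u fR≡R w = mk⇔ (λ e → trans e fR≡R) (λ e → trans e (sym fR≡R))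

    columnsMatch-refl : ∀ {R} v → f R ≡ R → ColumnsMatch R v v
    columnsMatch-refl v fR≡R w = mk⇔ (λ e → trans e fR≡R) (λ e → trans e (sym fR≡R))

    module FlipAt {A B : Fin m} (t : Type2K22 𝒞 A B) where
      open Interspace t

      f-rel : ∀ b → f (rel b) ≡ rel (b xor S A B)
      f-rel b with S A B in SAB | f-S (rel b) A B fiberˡ fiberʳ (λ u v → rel-⊆ b)
      ... | false | _ , fixed = trans (fixed refl) (cong rel (sym (xor-identityʳ b)))
      ... | true  | flipped , _
        with fR≢R , fR⊆A×B ← flipped refl | u , v , uv≡fR ← nonempty (f (rel b)) =
        trans fR≡rel (cong rel (trans (≢⇒≡not {βˡ u xor βʳ v} {b} (fR≢R ∘ trans fR≡rel ∘ cong rel))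
                                      (sym (xor-true b))))
        where
        fR≡rel : f (rel b) ≡ rel (βˡ u xor βʳ v)
        fR≡rel = let (u∈A , v∈B) = fR⊆A×B u v uv≡fR in trans (sym uv≡fR) (col≡rel u∈A v∈B)

      f-col : ∀ {x y} → col x x ≡ A → col y y ≡ B → f (col x y) ≡ rel ((βˡ x xor βʳ y) xor S A B)
      f-col {x} {y} x∈A y∈B = trans (cong f (col≡rel x∈A y∈B)) (f-rel (βˡ x xor βʳ y))

      f-col-injective : ∀ {x y x' y'} → col x x ≡ A → col y y ≡ B → col x' x' ≡ A → col y' y' ≡ B →
                        f (col x y) ≡ f (col x' y') → col x y ≡ col x' y'
      f-col-injective {x} {y} {x'} {y'} x∈A y∈B x'∈A y'∈B fxy≡fx'y' =
        from (col≡col⇔ x∈A y∈B x'∈A y'∈B) (xor-cancelʳ (βˡ x xor βʳ y) (βˡ x' xor βʳ y') (S A B)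
          (rel-injective (trans (sym (f-col x∈A y∈B)) (trans fxy≡fx'y' (f-col x'∈A y'∈B)))))

      move : ∀ {u v u' v'} s t → col u u ≡ A → col v v ≡ B → col u' u' ≡ A → col v' v' ≡ B →
             βˡ u' ≡ βˡ u xor s → βʳ v' ≡ βʳ v xor t → s xor t ≡ S A B → col u' v' ≡ f (col u v)
      move {u} {v} {u'} {v'} s t u∈A v∈B u'∈A v'∈B u'-shifted v'-shifted s+t = begin
        col u' v'                             ≡⟨ col≡rel u'∈A v'∈B ⟩
        rel (βˡ u' xor βʳ v')                 ≡⟨ cong₂ (λ x y → rel (x xor y)) u'-shifted v'-shifted ⟩
        rel ((βˡ u xor s) xor (βʳ v xor t))   ≡⟨ cong rel (xor-interchange (βˡ u) s (βʳ v) t) ⟩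
        rel ((βˡ u xor βʳ v) xor (s xor t))   ≡⟨ cong (λ x → rel ((βˡ u xor βʳ v) xor x)) s+t ⟩
        rel ((βˡ u xor βʳ v) xor S A B)       ≡⟨ f-col u∈A v∈B ⟨
        f (col u v)                           ∎
        where open ≡-Reasoning

      moveˡ : ∀ {u u' w} → col u u ≡ A → col u' u' ≡ A → βˡ u' ≡ βˡ u xor S A B →
              col w w ≡ B → col u' w ≡ f (col u w)
      moveˡ {w = w} u∈A u'∈A shifted w∈B =
        move (S A B) false u∈A w∈B u'∈A w∈B shifted (sym (xor-identityʳ (βʳ w))) (xor-identityʳ (S A B))

      moveʳ : ∀ {v v' w} → col v v ≡ B → col v' v' ≡ B → βʳ v' ≡ βʳ v xor S A B →
              col w w ≡ A → col w v' ≡ f (col w v)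
      moveʳ {w = w} v∈B v'∈B shifted w∈A =
        move false (S A B) w∈A v∈B w∈A v'∈B (sym (xor-identityʳ (βˡ w))) shifted refl

      rowsMatch : ∀ {u u' a b} → col u u ≡ A → col u' u' ≡ A → col a a ≡ A → col b b ≡ B →
                  βˡ u' ≡ βˡ u xor S A B → RowsMatch (col a b) u u'
      rowsMatch u∈A u'∈A a∈A b∈B shifted w = mk⇔
        (λ u'w≡fab → let w∈B = trans (sym (proj₂ (f-col-fibers u'w≡fab))) b∈B in
          f-col-injective u∈A w∈B a∈A b∈B (trans (sym (moveˡ u∈A u'∈A shifted w∈B)) u'w≡fab))
        (λ uw≡ab → let w∈B = trans (target-fiber uw≡ab) b∈B in
          trans (moveˡ u∈A u'∈A shifted w∈B) (cong f uw≡ab))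

      columnsMatch : ∀ {v v' a b} → col v v ≡ B → col v' v' ≡ B → col a a ≡ A → col b b ≡ B →
                     βʳ v' ≡ βʳ v xor S A B → ColumnsMatch (col a b) v v'
      columnsMatch v∈B v'∈B a∈A b∈B shifted w = mk⇔
        (λ wv'≡fab → let w∈A = trans (sym (proj₁ (f-col-fibers wv'≡fab))) a∈A in
          f-col-injective w∈A v∈B a∈A b∈B (trans (sym (moveʳ v∈B v'∈B shifted w∈A)) wv'≡fab))
        (λ wv≡ab → let w∈A = trans (source-fiber wv≡ab) a∈A in
          trans (moveʳ v∈B v'∈B shifted w∈A) (cong f wv≡ab))

      f-col-other : ∀ {x y y'} → col x x ≡ A → col y y ≡ B → col y' y' ≡ B → S A B ≡ true →
                    col x y' ≢ col x y → col x y' ≡ f (col x y)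
      f-col-other {x} {y} {y'} x∈A y∈B y'∈B SAB≡true xy'≢xy = begin
        col x y'                          ≡⟨ col≡rel x∈A y'∈B ⟩
        rel (βˡ x xor βʳ y')
          ≡⟨ cong rel (≢⇒≡not (xy'≢xy ∘ from (col≡col⇔ x∈A y'∈B x∈A y∈B))) ⟩
        rel (not (βˡ x xor βʳ y))         ≡⟨ cong rel (xor-true (βˡ x xor βʳ y)) ⟨
        rel ((βˡ x xor βʳ y) xor true)    ≡⟨ cong (λ s → rel ((βˡ x xor βʳ y) xor s)) SAB≡true ⟨
        rel ((βˡ x xor βʳ y) xor S A B)   ≡⟨ f-col x∈A y∈B ⟨
        f (col x y)                       ∎
        where open ≡-Reasoning

-- Preservation of intersection numbers

two-or-zero⇔xor : ∀ a b c → let k = indicator a + (indicator b + indicator c) in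
                  (k ≡ 2 ⊎ k ≡ 0) ⇔ (b xor c ≡ a)
two-or-zero⇔xor false false false = mk⇔ (λ _ → refl) (λ _ → inj₂ refl)
two-or-zero⇔xor false false true  = mk⇔ (λ { (inj₁ ()) ; (inj₂ ()) }) (λ ())
two-or-zero⇔xor false true  false = mk⇔ (λ { (inj₁ ()) ; (inj₂ ()) }) (λ ())
two-or-zero⇔xor false true  true  = mk⇔ (λ _ → refl) (λ _ → inj₁ refl)
two-or-zero⇔xor true  false false = mk⇔ (λ { (inj₁ ()) ; (inj₂ ()) }) (λ ())
two-or-zero⇔xor true  false true  = mk⇔ (λ _ → refl) (λ _ → inj₁ refl)
two-or-zero⇔xor true  true  false = mk⇔ (λ _ → refl) (λ _ → inj₁ refl)
two-or-zero⇔xor true  true  true  = mk⇔ (λ { (inj₁ ()) ; (inj₂ ()) }) (λ ())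

module Harmonious {n m} (𝒞 : CoherentConfiguration n m) (H : ThreeHarmonious 𝒞) where
  open CoherentConfiguration 𝒞
  open Configuration 𝒞
  open ThreeHarmonious H
  open Irredundant irredundant

  private
    _⇔?_ : ∀ {P Q : Set} → Dec P → Dec Q → Dec (P ⇔ Q)
    P? ⇔? Q? = map′ (λ (P→Q , Q→P) → mk⇔ P→Q Q→P) (λ P⇔Q → to P⇔Q , from P⇔Q)
                    ((P? →-dec Q?) ×-dec (Q? →-dec P?))

  uniform? : ∀ X Y → Dec (Uniform 𝒞 X Y)
  uniform? X Y = any? λ R → all? λ u → all? λ v → (col u v ≟ R) ⇔? ((col u u ≟ X) ×-dec (col v v ≟ Y))

  nonUniform? : ∀ X Y → Dec (NonUniform 𝒞 X Y)
  nonUniform? X Y = fiber? X ×-dec fiber? Y ×-dec ¬? (X ≟ Y) ×-dec ¬? (uniform? X Y)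
    where
    fiber? : ∀ X → Dec (IsFiber 𝒞 X)
    fiber? X = any? λ x → col x x ≟ X

  agreeOn? : ∀ X β β' → Dec (AgreeOn X β β')
  agreeOn? X β β' = map′ (λ agree {x} {x'} → agree x x') (λ agree x x' → agree)
    (all? λ x → all? λ x' →
       (col x x ≟ X) →-dec ((col x' x' ≟ X) →-dec ((β x xor β x') ≟ᵇ (β' x xor β' x'))))

  module _ {X Z : Fin m} (XZ-nonUniform : NonUniform 𝒞 X Z) where
    private
      tZX = transpose (type2K22 X Z XZ-nonUniform)

      directlyConnected? : ∀ W → Dec (NonUniform 𝒞 W X × DirectlyConnected 𝒞 W Z X)
      directlyConnected? W with nonUniform? W X
      ... | no ¬WX = no (¬WX ∘ proj₁)
      ... | yes WX with agreeOn? X βʳ[ type2K22 W X WX ] βʳ[ tZX ]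
      ...   | yes agree = yes (WX , agree⇒directlyConnected (type2K22 W X WX) tZX agree)
      ...   | no ¬agree =
        no λ (_ , connected) → ¬agree (directlyConnected⇒agree connected (type2K22 W X WX) tZX)

      inD? : ∀ W → Dec (InD 𝒞 X Z W)
      inD? W = (W ≟ X) ⊎-dec ((W ≟ Z) ⊎-dec directlyConnected? W)

    D : Subset m
    D = subset inD?

    ∈D⇔InD : ∀ W → W ∈ D ⇔ InD 𝒞 X Z W
    ∈D⇔InD = ∈-subset inD?

    D∈𝒟 : InFamD 𝒞 D
    D∈𝒟 = X , Z , XZ-nonUniform , ∈D⇔InD

  module _ (S : Fin m → Fin m → Bool) (S-sym : ∀ X Y → S X Y ≡ S Y X) where

    two-or-zero⇔triangle-xor : ∀ {C X Y Z} → InFamD 𝒞 C → X ∈ C → Y ∈ C → Z ∈ C → X ≢ Y → X ≢ Z → Y ≢ Z →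
                               (edgeCount S C ≡ 2 ⊎ edgeCount S C ≡ 0) ⇔ (S X Z xor S Y Z ≡ S X Y)
    two-or-zero⇔triangle-xor {C} {X} {Y} {Z} C∈𝒟 X∈C Y∈C Z∈C X≢Y X≢Z Y≢Z =
      subst (λ k → (k ≡ 2 ⊎ k ≡ 0) ⇔ (S X Z xor S Y Z ≡ S X Y))
            (sym (edgeCount-triangle S S-sym X≢Y X≢Z Y≢Z
                   (triangle-members (three-elements C C∈𝒟) X∈C Y∈C Z∈C X≢Y X≢Z Y≢Z)))
            (two-or-zero⇔xor (S X Y) (S X Z) (S Y Z))

  module Backward (S : Fin m → Fin m → Bool) (S-edges : IsEdgeSet 𝒞 S)
                  (f : Fin m → Fin m) (f-S : IsFS 𝒞 S f)
                  (two-or-zero : ∀ C → InFamD 𝒞 C → edgeCount S C ≡ 2 ⊎ edgeCount S C ≡ 0) where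
    open Flip S S-edges f f-S

    connected-parity : ∀ {X Y Z} → NonUniform 𝒞 X Z → NonUniform 𝒞 Y X → DirectlyConnected 𝒞 Y Z X →
                       Y ≢ Z → S X Y xor S Y Z ≡ S X Z
    connected-parity {X} {Y} {Z} XZ YX connected Y≢Z =
      trans (cong (S X Y xor_) (S-sym Y Z))
            (to (two-or-zero⇔triangle-xor S S-sym (D∈𝒟 XZ) X∈D Z∈D Y∈D X≢Z X≢Y (Y≢Z ∘ sym))
                (two-or-zero _ (D∈𝒟 XZ)))
      where
      X≢Z = proj₁ (proj₂ (proj₂ XZ))
      X≢Y = proj₁ (proj₂ (proj₂ YX)) ∘ sym
      X∈D = from (∈D⇔InD XZ X) (inj₁ refl)
      Z∈D = from (∈D⇔InD XZ Z) (inj₂ (inj₁ refl))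
      Y∈D = from (∈D⇔InD XZ Y) (inj₂ (inj₂ (YX , connected)))

    Transported : Fin n → Fin n → Fin m → Fin m → Set
    Transported u v R R' = ∃₂ λ u' v' → col u' v' ≡ f (col u v) ×
                           count (path? u v R R') ≡ count (path? u' v' (f R) (f R'))

    transported : ∀ {u v u' v' R R'} → RowsMatch R u u' → ColumnsMatch R' v v' →
                  col u' v' ≡ f (col u v) → Transported u v R R'
    transported {u' = u'} {v'} rows columns u'v'≡fuv =
      u' , v' , u'v'≡fuv , sym (count-cong _ _ λ w → rows w ×-⇔ columns w)

    transported-mismatch : ∀ {u v a b c d} →
                           ¬ (col a a ≡ col u u × col b b ≡ col c c × col d d ≡ col v v) →
                           Transported u v (col a b) (col c d)
    transported-mismatch {u} {v} {a} {b} {c} {d} mismatch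
      with u' , v' , u'v'≡fuv ← nonempty (f (col u v)) =
      u' , v' , u'v'≡fuv , trans (count≡0 _ no-path) (sym (count≡0 _ no-f-path))
      where
      no-path : ∀ w → ¬ (col u w ≡ col a b × col w v ≡ col c d)
      no-path w (uw≡ab , wv≡cd) = mismatch
        ( sym (source-fiber uw≡ab)
        , trans (sym (target-fiber uw≡ab)) (source-fiber wv≡cd)
        , sym (target-fiber wv≡cd))
      no-f-path : ∀ w → ¬ (col u' w ≡ f (col a b) × col w v' ≡ f (col c d))
      no-f-path w (u'w , wv') =
        let (u∼u' , v∼v') = f-col-fibers u'v'≡fuv
            (a∼u' , b∼w) = f-col-fibers u'w
            (c∼w , d∼v') = f-col-fibers wv'
        in mismatch (trans a∼u' (sym u∼u') , trans b∼w (sym c∼w) , trans d∼v' (sym v∼v'))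

    RowMove : Fin m → Fin m → Fin m → Fin n → Set
    RowMove X Y R u =
      ∃ λ u' → col u' u' ≡ X × RowsMatch R u u' × (∀ {w} → col w w ≡ Y → col u' w ≡ f (col u w))

    ColumnMove : Fin m → Fin m → Fin m → Fin n → Set
    ColumnMove Y Z R v =
      ∃ λ v' → col v' v' ≡ Z × ColumnsMatch R v v' × (∀ {w} → col w w ≡ Y → col w v' ≡ f (col w v))

    shifted-row : ∀ {X Y u a b} → col u u ≡ X → col a a ≡ X → col b b ≡ Y → RowMove X Y (col a b) u
    shifted-row {X} {Y} {u} {a} {b} u∈X a∈X b∈Y with S X Y in SXY
    ... | false =
      u , u∈X , rowsMatch-refl u (f-fixed-at a∈X b∈Y SXY) , λ w∈Y → sym (f-fixed-at u∈X w∈Y SXY)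
    ... | true = shift (type2K22 X Y (S⇒nonUniform SXY))
      where
      shift : Type2K22 𝒞 X Y → RowMove X Y (col a b) u
      shift t with u' , u'∈X , shifted ← point-in-block (Interspace.left t) (Interspace.βˡ t u xor S X Y) =
        u' , u'∈X , FlipAt.rowsMatch t u∈X u'∈X a∈X b∈Y shifted , FlipAt.moveˡ t u∈X u'∈X shifted

    shifted-column : ∀ {Y Z v c d} → col v v ≡ Z → col c c ≡ Y → col d d ≡ Z → ColumnMove Y Z (col c d) v
    shifted-column {Y} {Z} {v} {c} {d} v∈Z c∈Y d∈Z with S Y Z in SYZ
    ... | false =
      v , v∈Z , columnsMatch-refl v (f-fixed-at c∈Y d∈Z SYZ) , λ w∈Y → sym (f-fixed-at w∈Y v∈Z SYZ)
    ... | true = shift (type2K22 Y Z (S⇒nonUniform SYZ))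
      where
      shift : Type2K22 𝒞 Y Z → ColumnMove Y Z (col c d) v
      shift t with v' , v'∈Z , shifted ← point-in-block (Interspace.right t) (Interspace.βʳ t v xor S Y Z) =
        v' , v'∈Z , FlipAt.columnsMatch t v∈Z v'∈Z c∈Y d∈Z shifted , FlipAt.moveʳ t v∈Z v'∈Z shifted

    transported-left-cell : ∀ {X Z u v a b c d} → col u u ≡ X → col v v ≡ Z →
                            col a a ≡ X → col b b ≡ X → col c c ≡ X → col d d ≡ Z →
                            Transported u v (col a b) (col c d)
    transported-left-cell u∈X v∈Z a∈X b∈X c∈X d∈Z
      with v' , _ , columns , move ← shifted-column v∈Z c∈X d∈Z =
      transported (rowsMatch-refl _ (f-cell (trans a∈X (sym b∈X)))) columns (move u∈X)

    transported-right-cell : ∀ {X Z u v a b c d} → col u u ≡ X → col v v ≡ Z →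
                             col a a ≡ X → col b b ≡ Z → col c c ≡ Z → col d d ≡ Z →
                             Transported u v (col a b) (col c d)
    transported-right-cell u∈X v∈Z a∈X b∈Z c∈Z d∈Z
      with u' , _ , rows , move ← shifted-row u∈X a∈X b∈Z =
      transported rows (columnsMatch-refl _ (f-cell (trans c∈Z (sym d∈Z)))) (move v∈Z)

    swap-path : ∀ {X Y u v a b c d} (t : Type2K22 𝒞 X Y) → S X Y ≡ true →
                col a a ≡ X → col b b ≡ Y → col c c ≡ Y → col d d ≡ X → ∀ w →
                Path u v (f (col a b)) (f (col c d)) (swap (Interspace.right t) w) ⇔
                Path u v (col a b) (col c d) w
    swap-path {X} {Y} {u} {v} {a} {b} {c} {d} t SXY a∈X b∈Y c∈Y d∈X w = by-membership (col w w ≟ Y)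
      where
      open Interspace t
      σ = swap right
      by-membership : Dec (col w w ≡ Y) →
                      Path u v (f (col a b)) (f (col c d)) (σ w) ⇔ Path u v (col a b) (col c d) w
      by-membership (yes w∈Y) =
        FlipAt.columnsMatch t w∈Y σw∈Y a∈X b∈Y σw-shifted u ×-⇔
        FlipAt.rowsMatch (transpose t) w∈Y σw∈Y c∈Y d∈X (trans σw-shifted (cong (βʳ w xor_) (S-sym X Y))) v
        where
        σw∈Y = proj₁ (swap-∈ right w∈Y)
        σw-shifted : βʳ (σ w) ≡ βʳ w xor S X Y
        σw-shifted = trans (proj₂ (swap-∈ right w∈Y))
                           (trans (sym (xor-true (βʳ w))) (cong (βʳ w xor_) (sym SXY)))
      by-membership (no w∉Y) = mk⇔
        (λ (uσw≡fab , _) → ⊥-elim (w∉Y (trans (sym (proj₂ (f-col-fibers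
           (subst (λ x → col u x ≡ f (col a b)) (swap-outside right w w∉Y) uσw≡fab)))) b∈Y)))
        (λ (uw≡ab , _) → ⊥-elim (w∉Y (trans (target-fiber uw≡ab) b∈Y)))

    -- Here f fixes T, so (u, v) stays put; instead the midpoint is moved, by swapping the blocks of Y.
    transported-return : ∀ {X Y u v a b c d} → col u u ≡ X → col v v ≡ X →
                         col a a ≡ X → col b b ≡ Y → col c c ≡ Y → col d d ≡ X →
                         Transported u v (col a b) (col c d)
    transported-return {X} {Y} {u} {v} {a} {b} {c} {d} u∈X v∈X a∈X b∈Y c∈Y d∈X with S X Y in SXY
    ... | false = transported (rowsMatch-refl u (f-fixed-at a∈X b∈Y SXY))
                              (columnsMatch-refl v (f-fixed-at c∈Y d∈X (trans (S-sym Y X) SXY)))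
                              (sym (f-cell (trans u∈X (sym v∈X))))
    ... | true = u , v , sym (f-cell (trans u∈X (sym v∈X))) ,
                 sym (trans (count-involution _ (swap right) (swap-involutive right))
                            (count-cong _ _ (swap-path t SXY a∈X b∈Y c∈Y d∈X)))
      where
      t = type2K22 X Y (S⇒nonUniform SXY)
      right = Interspace.right t

    ShiftedRow : Fin m → (Fin n → Bool) → Fin n → Fin m → Bool → Set
    ShiftedRow X β u R s = ∃ λ u' → col u' u' ≡ X × RowsMatch R u u' × β u' ≡ β u xor s

    ShiftedColumn : Fin m → (Fin n → Bool) → Fin n → Fin m → Bool → Set
    ShiftedColumn Z β v R s = ∃ λ v' → col v' v' ≡ Z × ColumnsMatch R v v' × β v' ≡ β v xor s

    RowShifts : ∀ {X Z} → Type2K22 𝒞 X Z → Fin m → Fin n → Fin m → Set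
    RowShifts {X} {Z} tXZ Y u R =
      (∀ s → ShiftedRow X (Interspace.βˡ tXZ) u R s) ⊎
      (ShiftedRow X (Interspace.βˡ tXZ) u R (S X Y) × NonUniform 𝒞 Y X × DirectlyConnected 𝒞 Y Z X)

    row-shifts : ∀ {X Y Z u a b} (tXZ : Type2K22 𝒞 X Z) → Y ≢ X →
                 col u u ≡ X → col a a ≡ X → col b b ≡ Y → RowShifts tXZ Y u (col a b)
    row-shifts {X} {Y} {Z} {u} {a} {b} tXZ Y≢X u∈X a∈X b∈Y with uniform? X Y
    ... | yes uniform = inj₁ λ s →
      let (u' , u'∈X , shifted) = point-in-block (Interspace.left tXZ) (Interspace.βˡ tXZ u xor s)
      in u' , u'∈X , uniform-rows u'∈X , shifted
      where
      fixed = f-fixed-at a∈X b∈Y (uniform⇒S≡false uniform)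
      uniform-rows : ∀ {u'} → col u' u' ≡ X → RowsMatch (col a b) u u'
      uniform-rows u'∈X w = mk⇔
        (λ u'w≡fab → let w∈Y = trans (sym (proj₂ (f-col-fibers u'w≡fab))) b∈Y in
                     trans (uniform-col uniform u∈X w∈Y u'∈X w∈Y) (trans u'w≡fab fixed))
        (λ uw≡ab → let w∈Y = trans (target-fiber uw≡ab) b∈Y in
                   trans (trans (uniform-col uniform u'∈X w∈Y u∈X w∈Y) uw≡ab) (sym fixed))
    ... | no ¬uniform = via (type2K22 X Y XY)
      where
      XY = (u , u∈X) , (b , b∈Y) , Y≢X ∘ sym , ¬uniform
      via : Type2K22 𝒞 X Y → RowShifts tXZ Y u (col a b)
      via tXY with agree-or-separate (Interspace.left tXY) (Interspace.left tXZ)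
      ... | inj₁ agree =
        let (u' , u'∈X , XY-shifted) = point-in-block (Interspace.left tXY) (Interspace.βˡ tXY u xor S X Y)
        in inj₂ ( (u' , u'∈X , FlipAt.rowsMatch tXY u∈X u'∈X a∈X b∈Y XY-shifted ,
                   agree-shift {β = Interspace.βˡ tXY} {Interspace.βˡ tXZ} agree u∈X u'∈X XY-shifted)
                , nonUniform-sym XY , agree⇒directlyConnected (transpose tXY) (transpose tXZ) agree)
      ... | inj₂ separate = inj₁ λ s →
        let (u' , u'∈X , XY-shifted , XZ-shifted) = separate u∈X (S X Y) s
        in u' , u'∈X , FlipAt.rowsMatch tXY u∈X u'∈X a∈X b∈Y XY-shifted , XZ-shifted

    ColumnShifts : ∀ {X Z} → Type2K22 𝒞 X Z → Fin m → Fin n → Fin m → Set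
    ColumnShifts {X} {Z} tXZ Y v R =
      (∀ s → ShiftedColumn Z (Interspace.βʳ tXZ) v R s) ⊎ ShiftedColumn Z (Interspace.βʳ tXZ) v R (S Y Z)

    column-shifts : ∀ {X Y Z v c d} (tXZ : Type2K22 𝒞 X Z) → Z ≢ Y →
                    col v v ≡ Z → col c c ≡ Y → col d d ≡ Z → ColumnShifts tXZ Y v (col c d)
    column-shifts {X} {Y} {Z} {v} {c} {d} tXZ Z≢Y v∈Z c∈Y d∈Z with uniform? Y Z
    ... | yes uniform = inj₁ λ s →
      let (v' , v'∈Z , shifted) = point-in-block (Interspace.right tXZ) (Interspace.βʳ tXZ v xor s)
      in v' , v'∈Z , uniform-columns v'∈Z , shifted
      where
      fixed = f-fixed-at c∈Y d∈Z (uniform⇒S≡false uniform)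
      uniform-columns : ∀ {v'} → col v' v' ≡ Z → ColumnsMatch (col c d) v v'
      uniform-columns v'∈Z w = mk⇔
        (λ wv'≡fcd → let w∈Y = trans (sym (proj₁ (f-col-fibers wv'≡fcd))) c∈Y in
                     trans (uniform-col uniform w∈Y v∈Z w∈Y v'∈Z) (trans wv'≡fcd fixed))
        (λ wv≡cd → let w∈Y = trans (source-fiber wv≡cd) c∈Y in
                   trans (trans (uniform-col uniform w∈Y v'∈Z w∈Y v∈Z) wv≡cd) (sym fixed))
    ... | no ¬uniform = via (type2K22 Y Z ((c , c∈Y) , (v , v∈Z) , Z≢Y ∘ sym , ¬uniform))
      where
      via : Type2K22 𝒞 Y Z → ColumnShifts tXZ Y v (col c d)
      via tYZ with agree-or-separate (Interspace.right tYZ) (Interspace.right tXZ)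
      ... | inj₁ agree =
        let (v' , v'∈Z , YZ-shifted) = point-in-block (Interspace.right tYZ) (Interspace.βʳ tYZ v xor S Y Z)
        in inj₂ (v' , v'∈Z , FlipAt.columnsMatch tYZ v∈Z v'∈Z c∈Y d∈Z YZ-shifted ,
                 agree-shift {β = Interspace.βʳ tYZ} {Interspace.βʳ tXZ} agree v∈Z v'∈Z YZ-shifted)
      ... | inj₂ separate = inj₁ λ s →
        let (v' , v'∈Z , YZ-shifted , XZ-shifted) = separate v∈Z (S Y Z) s
        in v' , v'∈Z , FlipAt.columnsMatch tYZ v∈Z v'∈Z c∈Y d∈Z YZ-shifted , XZ-shifted

    transported-distinct : ∀ {X Y Z u v a b c d} → Y ≢ X → Z ≢ Y → Z ≢ X → col u u ≡ X → col v v ≡ Z →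
                           col a a ≡ X → col b b ≡ Y → col c c ≡ Y → col d d ≡ Z →
                           Transported u v (col a b) (col c d)
    transported-distinct {X} {Y} {Z} {u} {v} {a} {b} {c} {d} Y≢X Z≢Y Z≢X u∈X v∈Z a∈X b∈Y c∈Y d∈Z
      with uniform? X Z
    ... | yes uniform =
      let (u' , u'∈X , rows , _) = shifted-row u∈X a∈X b∈Y
          (v' , v'∈Z , columns , _) = shifted-column v∈Z c∈Y d∈Z
      in transported rows columns (trans (uniform-col uniform u'∈X v'∈Z u∈X v∈Z)
                                         (sym (f-fixed-at u∈X v∈Z (uniform⇒S≡false uniform))))
    ... | no ¬uniform = combine (row-shifts tXZ Y≢X u∈X a∈X b∈Y) (column-shifts tXZ Z≢Y v∈Z c∈Y d∈Z)
      where
      XZ = (u , u∈X) , (v , v∈Z) , Z≢X ∘ sym , ¬uniform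
      tXZ = type2K22 X Z XZ
      γ = Interspace.βʳ tXZ
      open FlipAt tXZ using (move)

      some-column : ColumnShifts tXZ Y v (col c d) → ∃ λ t → ShiftedColumn Z γ v (col c d) t
      some-column (inj₁ all) = false , all false
      some-column (inj₂ forced) = S Y Z , forced

      combine : RowShifts tXZ Y u (col a b) → ColumnShifts tXZ Y v (col c d) →
                Transported u v (col a b) (col c d)
      combine (inj₁ all-rows) column-shifts =
        let (t , v' , v'∈Z , columns , v'-shifted) = some-column column-shifts
            (u' , u'∈X , rows , u'-shifted) = all-rows (t xor S X Z)
        in transported rows columns (move (t xor S X Z) t u∈X v∈Z u'∈X v'∈Z u'-shifted v'-shifted
                                       (trans (xor-comm (t xor S X Z) t) (xor-absorbˡ t (S X Z))))
      combine (inj₂ ((u' , u'∈X , rows , u'-shifted) , _)) (inj₁ all-columns) =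
        let (v' , v'∈Z , columns , v'-shifted) = all-columns (S X Y xor S X Z)
        in transported rows columns (move (S X Y) (S X Y xor S X Z) u∈X v∈Z u'∈X v'∈Z u'-shifted v'-shifted
                                       (xor-absorbˡ (S X Y) (S X Z)))
      combine (inj₂ ((u' , u'∈X , rows , u'-shifted) , YX , connected))
              (inj₂ (v' , v'∈Z , columns , v'-shifted)) =
        transported rows columns (move (S X Y) (S Y Z) u∈X v∈Z u'∈X v'∈Z u'-shifted v'-shifted
                                       (connected-parity XZ YX connected (Z≢Y ∘ sym)))

    transported-at-fibers : ∀ {X Y Z u v a b c d} → col u u ≡ X → col v v ≡ Z →
                            col a a ≡ X → col b b ≡ Y → col c c ≡ Y → col d d ≡ Z →
                            Transported u v (col a b) (col c d)
    transported-at-fibers {X} {Y} {Z} u∈X v∈Z a∈X b∈Y c∈Y d∈Z with Y ≟ X | Z ≟ Y | Z ≟ X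
    ... | yes refl | _        | _        = transported-left-cell u∈X v∈Z a∈X b∈Y c∈Y d∈Z
    ... | no _     | yes refl | _        = transported-right-cell u∈X v∈Z a∈X b∈Y c∈Y d∈Z
    ... | no _     | no _     | yes refl = transported-return u∈X v∈Z a∈X b∈Y c∈Y d∈Z
    ... | no Y≢X   | no Z≢Y   | no Z≢X   = transported-distinct Y≢X Z≢Y Z≢X u∈X v∈Z a∈X b∈Y c∈Y d∈Z

    all-transported : ∀ u v a b c d → Transported u v (col a b) (col c d)
    all-transported u v a b c d with col a a ≟ col u u | col b b ≟ col c c | col d d ≟ col v v
    ... | yes a∼u | yes b∼c | yes d∼v = transported-at-fibers refl refl a∼u refl (sym b∼c) d∼v
    ... | no a≁u  | _       | _       = transported-mismatch (a≁u ∘ proj₁)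
    ... | yes _   | no b≁c  | _       = transported-mismatch (b≁c ∘ proj₁ ∘ proj₂)
    ... | yes _   | yes _   | no d≁v  = transported-mismatch (d≁v ∘ proj₂ ∘ proj₂)

    p-preserved : ∀ R R' T → p T R R' ≡ p (f T) (f R) (f R')
    p-preserved R R' T
      with u , v , refl ← nonempty T | a , b , refl ← nonempty R | c , d , refl ← nonempty R'
      with u' , v' , u'v'≡fuv , counts ← all-transported u v a b c d = begin
        p (col u v) (col a b) (col c d)                  ≡⟨ p≡count u v _ _ ⟩
        count (path? u v (col a b) (col c d))            ≡⟨ counts ⟩
        count (path? u' v' (f (col a b)) (f (col c d)))  ≡⟨ p≡count u' v' _ _ ⟨
        p (col u' v') (f (col a b)) (f (col c d))
          ≡⟨ cong (λ T → p T (f (col a b)) (f (col c d))) u'v'≡fuv ⟩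
        p (f (col u v)) (f (col a b)) (f (col c d))      ∎
      where open ≡-Reasoning

-- Parity of S from preserved intersection numbers

module Forward {n m} (𝒞 : CoherentConfiguration n m) (H : ThreeHarmonious 𝒞)
               (S : Fin m → Fin m → Bool) (S-edges : IsEdgeSet 𝒞 S)
               (f : Fin m → Fin m) (f-S : IsFS 𝒞 S f)
               (p-preserved : ∀ R R' T → CoherentConfiguration.p 𝒞 T R R' ≡
                                         CoherentConfiguration.p 𝒞 (f T) (f R) (f R')) where
  open CoherentConfiguration 𝒞
  open Configuration 𝒞
  open Flip S S-edges f f-S
  open Harmonious 𝒞 H
  open ThreeHarmonious H
  open Irredundant irredundant

  module _ {X Y Z : Fin m} (tZX : Type2K22 𝒞 Z X) (tYX : Type2K22 𝒞 Y X)
           (β~βʸ : AgreeOn X βʳ[ tZX ] βʳ[ tYX ]) where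
    open ≡-Reasoning

    private
      tXZ = transpose tZX
      β = Interspace.βʳ tZX
      βʸ = Interspace.βʳ tYX
      γ = Interspace.βʳ tXZ
      y = Type2K22.ex tYX zero
      y∈Y = Type2K22.ex-in tYX zero
      z = Type2K22.ex tZX zero
      z∈Z = Type2K22.ex-in tZX zero
      x₀ = Type2K22.ey tYX zero
      x₀∈X = Type2K22.ey-in tYX zero

      paths : Fin n → Fin n → Fin n → ℕ
      paths x₁ x₂ z' = count (path? y z' (col y x₁) (col x₂ z))

      path⇔ : ∀ {x₁ x₂ z'} → col x₁ x₁ ≡ X → col x₂ x₂ ≡ X → col z' z' ≡ Z → ∀ w →
              Path y z' (col y x₁) (col x₂ z) w ⇔ ((col w w ≡ X × β w ≡ β x₁) × β w xor γ z' ≡ β x₂ xor γ z)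
      path⇔ {x₁} {x₂} {z'} x₁∈X x₂∈X z'∈Z w = mk⇔
        (λ (yw≡yx₁ , wz'≡x₂z) → let w∈X = trans (target-fiber yw≡yx₁) x₁∈X in
          (w∈X , from (same-block w∈X) (xor-cancelˡ βʸ-y (βʸ w) (βʸ x₁) (to (row-y w∈X) yw≡yx₁))) ,
          to (column-z w∈X) wz'≡x₂z)
        (λ ((w∈X , same) , e) → from (row-y w∈X) (cong (βʸ-y xor_) (to (same-block w∈X) same)) ,
                                from (column-z w∈X) e)
        where
        βʸ-y = Interspace.βˡ tYX y
        row-y = λ {w} w∈X → Interspace.col≡col⇔ tYX {y} {w} y∈Y w∈X y∈Y x₁∈X
        column-z = λ {w} w∈X → Interspace.col≡col⇔ tXZ {w} {z'} w∈X z'∈Z x₂∈X z∈Z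
        same-block = λ {w} w∈X → xor≡⇒≡⇔≡ {β w} {β x₁} {βʸ w} {βʸ x₁} (β~βʸ w∈X x₁∈X)

      -- Agreement of the two partitions of X makes the midpoints either a whole block of X or nothing.
      paths≡2 : ∀ {x₁ x₂ z'} → col x₁ x₁ ≡ X → col x₂ x₂ ≡ X → col z' z' ≡ Z →
                β x₁ xor γ z' ≡ β x₂ xor γ z → paths x₁ x₂ z' ≡ 2
      paths≡2 {x₁} {x₂} {z'} x₁∈X x₂∈X z'∈Z aligned =
        trans (count-cong _ _ λ w → mk⇔ (proj₁ ∘ to (path⇔ x₁∈X x₂∈X z'∈Z w)) λ (w∈X , same) →
                 from (path⇔ x₁∈X x₂∈X z'∈Z w) ((w∈X , same) , trans (cong (_xor γ z') same) aligned))
              (block-size (Interspace.right tZX) (β x₁))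

      paths≡0 : ∀ {x₁ x₂ z'} → col x₁ x₁ ≡ X → col x₂ x₂ ≡ X → col z' z' ≡ Z →
                β x₁ xor γ z' ≢ β x₂ xor γ z → paths x₁ x₂ z' ≡ 0
      paths≡0 {x₁} x₁∈X x₂∈X z'∈Z misaligned = count≡0 _ λ w path →
        let ((_ , same) , e) = to (path⇔ x₁∈X x₂∈X z'∈Z w) path
        in misaligned (trans (cong (_xor _) (sym same)) e)

      x₁-shifted = point-in-block (Interspace.right tYX) (βʸ x₀ xor S Y X)
      x₁ = proj₁ x₁-shifted
      x₁∈X = proj₁ (proj₂ x₁-shifted)
      yx₁≡fyx₀ : col y x₁ ≡ f (col y x₀)
      yx₁≡fyx₀ = FlipAt.moveʳ tYX x₀∈X x₁∈X (proj₂ (proj₂ x₁-shifted)) y∈Y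

      x₂-shifted = point-in-block (Interspace.left tXZ) (β x₀ xor S X Z)
      x₂ = proj₁ x₂-shifted
      x₂∈X = proj₁ (proj₂ x₂-shifted)
      x₂z≡fx₀z : col x₂ z ≡ f (col x₀ z)
      x₂z≡fx₀z = FlipAt.moveˡ tXZ x₀∈X x₂∈X (proj₂ (proj₂ x₂-shifted)) z∈Z

      -- Flipping the Z-block of z changes col y z, since it changes the path count below; as C[Y,Z]
      -- has only two basis relations, col y z' is then f (col y z).
      z'-shifted : ∃ λ z' → col z' z' ≡ Z × col y z' ≡ f (col y z) × γ z' ≡ γ z xor S Y Z
      z'-shifted with S Y Z in SYZ
      ... | false = z , z∈Z , sym (f-fixed-at y∈Y z∈Z SYZ) , sym (xor-identityʳ (γ z))
      ... | true with z' , z'∈Z , flipped ← point-in-block (Interspace.right tXZ) (γ z xor true) =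
        z' , z'∈Z , FlipAt.f-col-other (type2K22 Y Z (S⇒nonUniform SYZ)) y∈Y z∈Z z'∈Z SYZ yz'≢yz , flipped
        where
        yz'≢yz : col y z' ≢ col y z
        yz'≢yz yz'≡yz = case trans (sym (paths≡0 x₀∈X x₀∈X z'∈Z misaligned))
                                  (trans (count-path-cong _ _ yz'≡yz) (paths≡2 x₀∈X x₀∈X z∈Z refl)) of λ ()
          where
          misaligned : β x₀ xor γ z' ≢ β x₀ xor γ z
          misaligned e = not-¬ refl (trans (sym (xor-cancelˡ (β x₀) (γ z') (γ z) e))
                                           (trans flipped (xor-true (γ z))))
      z' = proj₁ z'-shifted
      z'∈Z = proj₁ (proj₂ z'-shifted)

      image-paths≡2 : paths x₁ x₂ z' ≡ 2
      image-paths≡2 = begin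
        paths x₁ x₂ z'                                 ≡⟨ p≡count y z' _ _ ⟨
        p (col y z') (col y x₁) (col x₂ z)
          ≡⟨ cong₂ (λ T R → p T R (col x₂ z)) yz'≡fyz yx₁≡fyx₀ ⟩
        p (f (col y z)) (f (col y x₀)) (col x₂ z)      ≡⟨ cong (p (f (col y z)) (f (col y x₀))) x₂z≡fx₀z ⟩
        p (f (col y z)) (f (col y x₀)) (f (col x₀ z))  ≡⟨ p-preserved _ _ _ ⟨
        p (col y z) (col y x₀) (col x₀ z)              ≡⟨ p≡count y z _ _ ⟩
        paths x₀ x₀ z                                  ≡⟨ paths≡2 x₀∈X x₀∈X z∈Z refl ⟩
        2                                              ∎
        where yz'≡fyz = proj₁ (proj₂ (proj₂ z'-shifted))

      aligned : β x₁ xor γ z' ≡ β x₂ xor γ z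
      aligned with β x₁ xor γ z' ≟ᵇ β x₂ xor γ z
      ... | yes aligned = aligned
      ... | no misaligned = case trans (sym image-paths≡2) (paths≡0 x₁∈X x₂∈X z'∈Z misaligned) of λ ()

      shifts-cancel : (β x₀ xor γ z) xor (S Y X xor S Y Z) ≡ (β x₀ xor γ z) xor S X Z
      shifts-cancel = begin
        (β x₀ xor γ z) xor (S Y X xor S Y Z)   ≡⟨ xor-interchange (β x₀) (S Y X) (γ z) (S Y Z) ⟨
        (β x₀ xor S Y X) xor (γ z xor S Y Z)   ≡⟨ cong₂ _xor_ β-x₁ γ-z' ⟨
        β x₁ xor γ z'                          ≡⟨ aligned ⟩
        β x₂ xor γ z                           ≡⟨ cong (_xor γ z) (proj₂ (proj₂ x₂-shifted)) ⟩
        (β x₀ xor S X Z) xor γ z               ≡⟨ xor-swapʳ (β x₀) (γ z) (S X Z) ⟩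
        (β x₀ xor γ z) xor S X Z               ∎
        where
        β-x₁ = agree-shift {β = βʸ} {β} (agree-sym {β = β} {βʸ} β~βʸ) x₀∈X x₁∈X
                           (proj₂ (proj₂ x₁-shifted))
        γ-z' = proj₂ (proj₂ (proj₂ z'-shifted))

    agreeing-xor : S X Z xor S Y Z ≡ S X Y
    agreeing-xor = begin
      S X Z xor S Y Z               ≡⟨ cong (_xor S Y Z) (xor-cancelˡ (β x₀ xor γ z) _ _ shifts-cancel) ⟨
      (S Y X xor S Y Z) xor S Y Z   ≡⟨ xor-involutiveʳ (S Y X) (S Y Z) ⟩
      S Y X                         ≡⟨ S-sym Y X ⟩
      S X Y                         ∎

  connected-xor : ∀ {X Y Z} → DirectlyConnected 𝒞 Z Y X → S X Z xor S Y Z ≡ S X Y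
  connected-xor connected@(tZX , tYX , _) =
    agreeing-xor tZX tYX (directlyConnected⇒agree connected tZX tYX)

  two-or-zero : ∀ C → InFamD 𝒞 C → edgeCount S C ≡ 2 ⊎ edgeCount S C ≡ 0
  two-or-zero C C∈𝒟@(X , Y , XY , C⇔) = with-third (third-member (three-elements C C∈𝒟) X∈C Y∈C)
    where
    X∈C = from (C⇔ X) (inj₁ refl)
    Y∈C = from (C⇔ Y) (inj₂ (inj₁ refl))
    with-third : (∃ λ Z → Z ∈ C × Z ≢ X × Z ≢ Y) → edgeCount S C ≡ 2 ⊎ edgeCount S C ≡ 0
    with-third (Z , Z∈C , Z≢X , Z≢Y) with to (C⇔ Z) Z∈C
    ... | inj₁ Z≡X                    = ⊥-elim (Z≢X Z≡X)
    ... | inj₂ (inj₁ Z≡Y)             = ⊥-elim (Z≢Y Z≡Y)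
    ... | inj₂ (inj₂ (_ , connected)) =
      from (two-or-zero⇔triangle-xor S S-sym C∈𝒟 X∈C Y∈C Z∈C X≢Y (Z≢X ∘ sym) (Z≢Y ∘ sym))
           (connected-xor connected)
      where X≢Y = proj₁ (proj₂ (proj₂ XY))

module FlipOfIrredundant {n m} (𝒞 : CoherentConfiguration n m) (irredundant : Irredundant 𝒞)
                         (S : Fin m → Fin m → Bool) (S-edges : IsEdgeSet 𝒞 S)
                         (f : Fin m → Fin m) (f-S : IsFS 𝒞 S f) where
  open CoherentConfiguration 𝒞
  open Configuration 𝒞
  open Flip S S-edges f f-S
  open Irredundant irredundant

  f-involutive : ∀ R → f (f R) ≡ R
  f-involutive R with a , b , refl ← nonempty R with S (col a a) (col b b) in SAB
  ... | false = trans (cong f (f-fixed SAB)) (f-fixed SAB)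
  ... | true  = flipped-twice (type2K22 (col a a) (col b b) (S⇒nonUniform SAB))
    where
    flipped-twice : Type2K22 𝒞 (col a a) (col b b) → f (f (col a b)) ≡ col a b
    flipped-twice t = begin
      f (f (col a b))           ≡⟨ cong f (f-col refl refl) ⟩
      f (rel (c xor s))         ≡⟨ f-rel (c xor s) ⟩
      rel ((c xor s) xor s)     ≡⟨ cong rel (xor-involutiveʳ c s) ⟩
      rel c                     ≡⟨ col≡rel refl refl ⟨
      col a b                   ∎
      where
      open ≡-Reasoning
      open Interspace t
      open FlipAt t
      c = βˡ a xor βʳ b
      s = S (col a a) (col b b)

  f-bijective : Bijective _≡_ _≡_ f
  f-bijective = inverseᵇ⇒bijective
    (strictlyInverseˡ⇒inverseˡ f f-involutive , strictlyInverseʳ⇒inverseʳ f f-involutive)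

  f-fixes-cells : ∀ R X → IsFiber 𝒞 X → InRel 𝒞 R X X → f R ≡ R
  f-fixes-cells R X _ R⊆X×X with a , b , refl ← nonempty R =
    let (a∈X , b∈X) = R⊆X×X a b refl in f-cell (trans a∈X (sym b∈X))

lemma9p4 : ∀ {n m} (𝒞 : CoherentConfiguration n m) → ThreeHarmonious 𝒞 →
    (S : Fin m → Fin m → Bool) → IsEdgeSet 𝒞 S →
    (f : Fin m → Fin m) → IsFS 𝒞 S f →
    (StrictAlgAut 𝒞 f ⇔
      (∀ C → InFamD 𝒞 C → edgeCount S C ≡ 2 ⊎ edgeCount S C ≡ 0))
lemma9p4 𝒞 H S S-edges f f-S = mk⇔
  (λ (_ , p-preserved , _) → Forward.two-or-zero 𝒞 H S S-edges f f-S p-preserved)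
  (λ two-or-zero → f-bijective , Backward.p-preserved S S-edges f f-S two-or-zero , f-fixes-cells)
  where
  open FlipOfIrredundant 𝒞 (ThreeHarmonious.irredundant H) S S-edges f f-S
  open Harmonious 𝒞 H
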